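{- If $G$ is a graph on $n$ vertices with minimum degree $\delta(G)\geqslant(1-\frac{2}{33})n$, then $W'_G(O)\leqslant1$ for every $O\in\mathcal{OK}_4(G)$.
   Context: For $S\subseteq V(G)$ nonempty, $N(S)=\bigcap_{v\in S}N(v)$, also written $N(v_1,\dots,v_r)$. An ordered $l$-clique is an $l$-tuple of distinct vertices forming a clique; $\mathcal{OK}_l(G)$ is the set of them, and $V((v_1,\dots,v_l))=\{v_1,\dots,v_l\}$. For $O=(u_1,\dots,u_4)\in\mathcal{OK}_4(G)$, $\mathcal{OK}_6(G,O)$ is the set of $(v_1,\dots,v_6)\in\mathcal{OK}_6(G)$ such that $u_1u_2u_3u_4$ is a (not necessarily consecutive) subsequence of $v_1\dots v_6$. For $(v_1,\dots,v_r)\in\mathcal{OK}_r(G)$, $r\in\{2,\dots,5\}$, $W(v_1,\dots,v_r)=\prod_{i=2}^r\frac1{|N(v_1,\dots,v_i)|}$. For a copy $K$ of $K_6$ in $G$ and an edge $e$ of $K$, $\psi_{K,e}$ assigns to a copy $T$ of $K_4$ in $G$ the value $\frac12$ if $T\subseteq K$ and $e\cap V(T)=\emptyset$; $-\frac16$ if $T\subseteq K$ and $|e\cap V(T)|=1$; $\frac16$ if $T\subseteq K$ and $e\in E(T)$; $0$ otherwise. Define $$W_G(O)=\frac12\sum_{K=(v_1,\dots,v_6)\in\mathcal{OK}_6(G,O)}W(v_1,\dots,v_5)\,\psi_{G[V(K)],\{v_1,v_2\}}(G[V(O)])$$ and, for $O=(x_1,x_2,x_3,x_4)$, $W'_G(O)=1-\frac{12}{W(x_1,x_2,x_3)}W_G(O)$.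 -}

module Defs where

open import Data.Nat as ℕ using (ℕ; zero; suc)
open import Data.Integer as ℤ using (ℤ; +_; -[1+_])
open import Data.Fin as Fin using (Fin)
open import Data.Bool using (Bool; true; false; if_then_else_; _∧_; _∨_; not)
open import Data.List as List using (List; []; _∷_; _++_; [_]; allFin; concatMap; take; foldr)
open import Data.Bool.ListAction using (all; any)
open import Data.Nat.ListAction using (sum)
import Data.Vec.Functional as VF
open import Data.Rational as ℚ using (ℚ; 0ℚ; 1ℚ; _/_; 1/_)
open import Relation.Nullary using (does; yes; no)
open import Relation.Binary.PropositionalEquality using (_≡_)

record Graph (n : ℕ) : Set where
  field
    adj    : Fin n → Fin n → Bool
    sym    : ∀ u v → adj u v ≡ adj v u
    irrefl : ∀ v → adj v v ≡ false
open Graph public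

_==_ : ∀ {n} → Fin n → Fin n → Bool
x == y = does (x Fin.≟ y)

_∈ᵇ_ : ∀ {n} → Fin n → List (Fin n) → Bool
x ∈ᵇ xs = any (x ==_) xs

degree : ∀ {n} → Graph n → Fin n → ℕ
degree {n} G u = sum (List.map (λ v → if adj G u v then 1 else 0) (allFin n))

commonNbrCount : ∀ {n} → Graph n → List (Fin n) → ℕ
commonNbrCount {n} G S =
  sum (List.map (λ w → if all (λ v → adj G v w) S then 1 else 0) (allFin n))

isOrdClique : ∀ {n l} → Graph n → (Fin l → Fin n) → Bool
isOrdClique {n} {l} G v =
  all (λ i → all (λ j → (i == j) ∨ (adj G (v i) (v j) ∧ not (v i == v j)))
                 (allFin l))
      (allFin l)

allTuples : ∀ {n} (k : ℕ) → List (Fin k → Fin n)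
allTuples {n} zero    = [ (λ ()) ]
allTuples {n} (suc k) =
  concatMap (λ x → List.map (λ t → x VF.∷ t) (allTuples k)) (allFin n)

isSubseq : ∀ {n} → List (Fin n) → List (Fin n) → Bool
isSubseq []       _        = true
isSubseq (x ∷ xs) []       = false
isSubseq (x ∷ xs) (y ∷ ys) =
  ((x == y) ∧ isSubseq xs ys) ∨ isSubseq (x ∷ xs) ys

inOK6 : ∀ {n} → Graph n → (Fin 4 → Fin n) → (Fin 6 → Fin n) → Bool
inOK6 G O K = isOrdClique G K ∧ isSubseq (VF.toList O) (VF.toList K)

-- 1/k for a natural number k (only ever applied to k ≥ 1 below; 0 ↦ 0)
invℕ : ℕ → ℚ
invℕ zero    = 0ℚ
invℕ (suc k) = (+ 1) / suc k

-- total reciprocal on ℚ (only ever applied to nonzero values below)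
recip : ℚ → ℚ
recip q with q ℚ.≟ 0ℚ
... | yes _   = 0ℚ
... | no q≢0  = 1/_ q {{ℚ.≢-nonZero q≢0}}

fromℕ : ℕ → ℚ
fromℕ k = (+ k) / 1

-- W(v1,...,vr) = ∏_{i=2}^r 1/|N(v1,...,vi)|

private
  Wgo : ∀ {n} → Graph n → List (Fin n) → List (Fin n) → ℚ
  Wgo G acc []       = 1ℚ
  Wgo G acc (x ∷ xs) = invℕ (commonNbrCount G (acc ++ [ x ])) ℚ.* Wgo G (acc ++ [ x ]) xs

Wt : ∀ {n} → Graph n → List (Fin n) → ℚ
Wt G []       = 1ℚ
Wt G (v ∷ vs) = Wgo G [ v ] vs

-- ψ_{K,e}(T): K a K_6 given by its vertex set, e = {a,b} an edge of K,
-- T a K_4 given by its vertex set.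

ψ : ∀ {n} → List (Fin n) → Fin n → Fin n → List (Fin n) → ℚ
ψ Kv a b Tv with all (_∈ᵇ Kv) Tv | a ∈ᵇ Tv | b ∈ᵇ Tv
... | false | _     | _     = 0ℚ
... | true  | false | false = (+ 1) / 2
... | true  | true  | false = -[1+ 0 ] / 6
... | true  | false | true  = -[1+ 0 ] / 6
... | true  | true  | true  = (+ 1) / 6

W_G : ∀ {n} → Graph n → (Fin 4 → Fin n) → ℚ
W_G G O =
  ((+ 1) / 2) ℚ.*
  foldr ℚ._+_ 0ℚ
    (List.map
      (λ K → if inOK6 G O K
               then Wt G (take 5 (VF.toList K)) ℚ.*
                    ψ (VF.toList K) (K Fin.zero) (K (Fin.suc Fin.zero)) (VF.toList O)
               else 0ℚ)
      (allTuples 6))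

W′_G : ∀ {n} → Graph n → (Fin 4 → Fin n) → ℚ
W′_G G O =
  1ℚ ℚ.- (fromℕ 12 ℚ.* recip (Wt G (take 3 (VF.toList O)))) ℚ.* W_G G O

{-# OPTIONS --safe #-}
module Submission where

-- Since W(x₁,x₂,x₃) ≥ 0, W′_G(O) ≤ 1 amounts to W_G(O) ≥ 0.  Group the 6-cliques K that
-- contain O as a subsequence by their two remaining vertices (a , b): K is an interleaving
-- of O with (a , b), i.e. one of the 15 lattice paths from (0,0) to (4,2), and each prefix
-- of K has the common neighbourhood of {O₁,…,Oᵢ} ∪ {the first j of a, b}, where (i,j) is
-- the point the path has reached.  So the contribution of (a , b) is a fixed rational
-- function of the counts c(i,j) of these neighbourhoods.  Minimum degree (1 − 2/33)n makes
-- c drop by at most 2n/33 per step; together with monotonicity and supermodularity of c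
-- this bounds every ratio of counts, and the 15-term sum becomes an explicit sum of
-- nonnegative terms.

open import Defs hiding (sym)
open import Level using (0ℓ)
open import Function using (_∘_; id; mk⇔; _⇔_; Equivalence)
open import Data.Empty using (⊥; ⊥-elim)
open import Data.Unit using (⊤; tt)
open import Data.Product using (proj₁)
open import Data.Bool as Bool using (Bool; true; false; if_then_else_; _∧_; _∨_; not; T)
open import Data.Bool.Properties
  using (∧-assoc; ∨-zeroʳ; ∨-identityʳ; T-≡; T-∧; ∧-isCommutativeMonoid)
open import Data.Bool.ListAction using (all)
open import Data.Nat as ℕ using (ℕ; zero; suc; z≤n; s≤s)
import Data.Nat.Properties as ℕ
import Data.Nat.Tactic.RingSolver as ℕ-Solver
open import Data.Nat.ListAction using (sum)
import Data.Nat.Coprimality as Coprime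
open import Data.Integer as ℤ using (+_; -[1+_])
import Data.Integer.Properties as ℤ
open import Data.Fin as Fin using (Fin)
open import Data.List as List
  using (List; []; _∷_; [_]; _++_; map; foldr; concatMap; allFin; tabulate; length; replicate; take; drop)
import Data.List.Properties as List
open import Data.List.Membership.Propositional using (_∈_)
open import Data.List.Membership.Propositional.Properties using (∈-allFin; ∈-++⁺ˡ)
open import Data.List.Relation.Unary.Any using (here; there)
open import Data.List.Relation.Unary.All as All using (All; []; _∷_)
import Data.List.Relation.Unary.All.Properties as All
open import Data.List.Relation.Unary.AllPairs as AllPairs using (AllPairs; []; _∷_; allPairs?)
import Data.List.Relation.Unary.AllPairs.Properties as AllPairs
open import Data.List.Relation.Unary.Unique.Propositional using (Unique)
open import Data.List.Relation.Binary.Permutation.Propositional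
  using (_↭_; prep; ↭-refl; ↭-sym; ↭-trans; ↭-reflexive; ↭⇒↭ₛ; module PermutationReasoning)
import Data.List.Relation.Binary.Permutation.Propositional.Properties as ↭
import Data.List.Relation.Binary.Permutation.Setoid.Properties as ↭ₛ
import Data.Vec.Functional as VF
open import Data.Rational as ℚ using (ℚ; 0ℚ; 1ℚ; _+_; _*_; _-_; -_; _≤_; _/_; mkℚ)
open import Data.Rational.Properties
open import Relation.Nullary using (Dec; yes; no; does)
open import Relation.Nullary.Decidable using (True; toWitness; does-⇔; dec-true; dec-false; dec⇒maybe; T?)
open import Relation.Nullary.Negation using (contradiction)
open import Relation.Binary.PropositionalEquality hiding ([_])
import Tactic.RingSolver.Core.AlmostCommutativeRing as ACR
open import Tactic.RingSolver using (solve-∀)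

private
  variable
    A B : Set

ℚ-ring : ACR.AlmostCommutativeRing 0ℓ 0ℓ
ℚ-ring = ACR.fromCommutativeRing +-*-commutativeRing (λ p → dec⇒maybe (0ℚ ≟ p))

0≤q-p : ∀ {p q} → p ≤ q → 0ℚ ≤ q - p
0≤q-p {p} {q} p≤q = subst (_≤ q - p) (+-inverseʳ p) (+-monoˡ-≤ (- p) p≤q)

0≤q-p⇒p≤q : ∀ {p q} → 0ℚ ≤ q - p → p ≤ q
0≤q-p⇒p≤q {p} {q} 0≤q-p = subst₂ _≤_ (+-identityʳ p) (cancel p q) (+-monoʳ-≤ p 0≤q-p)
  where
  cancel : ∀ p q → p + (q - p) ≡ q
  cancel = solve-∀ ℚ-ring

*-mono-≤-nonNeg : ∀ {a b c d} → 0ℚ ≤ a → a ≤ b → 0ℚ ≤ c → c ≤ d → a * c ≤ b * d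
*-mono-≤-nonNeg {a} {b} {c} {d} 0≤a a≤b 0≤c c≤d =
  ≤-trans (*-monoʳ-≤-nonNeg c {{ℚ.nonNegative 0≤c}} a≤b)
          (*-monoˡ-≤-nonNeg b {{ℚ.nonNegative (≤-trans 0≤a a≤b)}} c≤d)

0≤* : ∀ {a b} → 0ℚ ≤ a → 0ℚ ≤ b → 0ℚ ≤ a * b
0≤* 0≤a 0≤b = *-mono-≤-nonNeg ≤-refl 0≤a ≤-refl 0≤b

fromℕ≡mkℚ : ∀ k → fromℕ k ≡ mkℚ (+ k) 0 (Coprime.sym (Coprime.1-coprimeTo k))
fromℕ≡mkℚ k = normalize-coprime (Coprime.sym (Coprime.1-coprimeTo k))

fromℕ-+ : ∀ a b → fromℕ (a ℕ.+ b) ≡ fromℕ a + fromℕ b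
fromℕ-+ a b rewrite fromℕ≡mkℚ a | fromℕ≡mkℚ b = cong (λ z → z / 1) (begin
  + (a ℕ.+ b)                    ≡⟨ ℤ.pos-+ a b ⟩
  + a ℤ.+ + b                    ≡⟨ cong₂ ℤ._+_ (ℤ.*-identityʳ (+ a)) (ℤ.*-identityʳ (+ b)) ⟨
  + a ℤ.* + 1 ℤ.+ + b ℤ.* + 1    ∎)
  where open ≡-Reasoning

fromℕ-* : ∀ a b → fromℕ (a ℕ.* b) ≡ fromℕ a * fromℕ b
fromℕ-* a b rewrite fromℕ≡mkℚ a | fromℕ≡mkℚ b = cong (λ z → z / 1) (ℤ.pos-* a b)

fromℕ-nonNeg : ∀ k → 0ℚ ≤ fromℕ k
fromℕ-nonNeg k rewrite fromℕ≡mkℚ k = nonNegative⁻¹ _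

fromℕ-mono-≤ : ∀ {a b} → a ℕ.≤ b → fromℕ a ≤ fromℕ b
fromℕ-mono-≤ {a} {b} a≤b = begin
  fromℕ a                       ≡⟨ +-identityʳ (fromℕ a) ⟨
  fromℕ a + 0ℚ                  ≤⟨ +-monoʳ-≤ (fromℕ a) (fromℕ-nonNeg (b ℕ.∸ a)) ⟩
  fromℕ a + fromℕ (b ℕ.∸ a)     ≡⟨ fromℕ-+ a (b ℕ.∸ a) ⟨
  fromℕ (a ℕ.+ (b ℕ.∸ a))       ≡⟨ cong fromℕ (ℕ.m+[n∸m]≡n a≤b) ⟩
  fromℕ b                       ∎
  where open ≤-Reasoning

invℕ-nonNeg : ∀ k → 0ℚ ≤ invℕ k
invℕ-nonNeg zero    = ≤-refl
invℕ-nonNeg (suc k) rewrite normalize-coprime {1} {k} (Coprime.1-coprimeTo (suc k)) = nonNegative⁻¹ _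

fromℕ*invℕ≡1 : ∀ k → k ≢ 0 → fromℕ k * invℕ k ≡ 1ℚ
fromℕ*invℕ≡1 zero    k≢0 = contradiction refl k≢0
fromℕ*invℕ≡1 (suc k) _ rewrite fromℕ≡mkℚ (suc k) | normalize-coprime {1} {k} (Coprime.1-coprimeTo (suc k)) =
  *-inverseʳ (mkℚ (+ suc k) 0 (Coprime.sym (Coprime.1-coprimeTo (suc k))))

recip-nonNeg : ∀ q → 0ℚ ≤ q → 0ℚ ≤ recip q
recip-nonNeg q 0≤q with q ≟ 0ℚ
... | yes _   = ≤-refl
... | no  q≢0 = 1/-nonNeg q 0≤q q≢0
  where
  1/-nonNeg : ∀ q → 0ℚ ≤ q → (q≢0 : q ≢ 0ℚ) → 0ℚ ≤ (ℚ.1/ q) {{ℚ.≢-nonZero q≢0}}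
  1/-nonNeg (mkℚ ℤ.+[1+ k ] d c) _           _   = nonNegative⁻¹ _
  1/-nonNeg (mkℚ (+ 0)      d c) _           q≢0 = ⊥-elim (ℕ.NonZero.nonZero (ℚ.≢-nonZero q≢0))
  1/-nonNeg (mkℚ -[1+ k ]   d c) (ℚ.*≤* ()) _

record Reciprocal (a ua : ℚ) : Set where
  field
    inverse : a * ua ≡ 1ℚ
    nonNeg  : 0ℚ ≤ ua

*-reciprocal : ∀ {a b ua ub} → Reciprocal a ua → Reciprocal b ub → Reciprocal (a * b) (ua * ub)
*-reciprocal {a} {b} {ua} {ub} ra rb = record
  { inverse = begin
      (a * b) * (ua * ub)     ≡⟨ regroup a b ua ub ⟩
      (a * ua) * (b * ub)     ≡⟨ cong₂ _*_ (Reciprocal.inverse ra) (Reciprocal.inverse rb) ⟩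
      1ℚ                      ∎
  ; nonNeg  = 0≤* (Reciprocal.nonNeg ra) (Reciprocal.nonNeg rb)
  }
  where
  open ≡-Reasoning
  regroup : ∀ a b ua ub → (a * b) * (ua * ub) ≡ (a * ua) * (b * ub)
  regroup = solve-∀ ℚ-ring

module _ {a b ua ub : ℚ} (ra : Reciprocal a ua) (rb : Reciprocal b ub) where
  open Reciprocal ra renaming (inverse to a*ua≡1; nonNeg to 0≤ua)
  open Reciprocal rb renaming (inverse to b*ub≡1; nonNeg to 0≤ub)

  reciprocal-gap : ∀ d → a ≤ b + d → 0ℚ ≤ ua - ub + d * (ua * ub)
  reciprocal-gap d a≤b+d = subst (0ℚ ≤_) gap≡ (0≤* (0≤* 0≤ua 0≤ub) (0≤q-p a≤b+d))
    where
    gap≡ : (ua * ub) * (b + d - a) ≡ ua - ub + d * (ua * ub)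
    gap≡ = begin
      (ua * ub) * (b + d - a)                          ≡⟨ expand a b d ua ub ⟩
      ua * (b * ub) - ub * (a * ua) + d * (ua * ub)    ≡⟨ cong₂ (λ s t → ua * s - ub * t + d * (ua * ub)) b*ub≡1 a*ua≡1 ⟩
      ua * 1ℚ - ub * 1ℚ + d * (ua * ub)                ≡⟨ cong₂ (λ s t → s - t + d * (ua * ub)) (*-identityʳ ua) (*-identityʳ ub) ⟩
      ua - ub + d * (ua * ub)                          ∎
      where
      open ≡-Reasoning
      expand : ∀ a b d ua ub → (ua * ub) * (b + d - a) ≡ ua * (b * ub) - ub * (a * ua) + d * (ua * ub)
      expand = solve-∀ ℚ-ring

  cross-invert : ∀ β γ → β * a ≤ γ * b → β * ub ≤ γ * ua
  cross-invert β γ βa≤γb =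
    subst₂ _≤_ (cancel β ub a*ua≡1) (trans (cong (γ * b *_) (*-comm ua ub)) (cancel γ ua b*ub≡1))
      (*-monoʳ-≤-nonNeg (ua * ub) {{ℚ.nonNegative (0≤* 0≤ua 0≤ub)}} βa≤γb)
    where
    cancel : ∀ κ w {e ue} → e * ue ≡ 1ℚ → (κ * e) * (ue * w) ≡ κ * w
    cancel κ w {e} {ue} e*ue≡1 = begin
      (κ * e) * (ue * w)     ≡⟨ regroup κ w e ue ⟩
      (κ * w) * (e * ue)     ≡⟨ cong (κ * w *_) e*ue≡1 ⟩
      (κ * w) * 1ℚ           ≡⟨ *-identityʳ (κ * w) ⟩
      κ * w                  ∎
      where
      open ≡-Reasoning
      regroup : ∀ κ w e ue → (κ * e) * (ue * w) ≡ (κ * w) * (e * ue)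
      regroup = solve-∀ ℚ-ring

infix 4 _≼⟨_⟩_

-- a ≤ κ * b, wrapped in a record so that a, κ and b stay inferable: unification cannot
-- split a product of rationals into its factors.
record _≼⟨_⟩_ (a κ b : ℚ) : Set where
  constructor scaled
  field
    ≤-scaled : a ≤ κ * b

≤-≼-trans : ∀ {a b c κ} → a ≤ b → b ≼⟨ κ ⟩ c → a ≼⟨ κ ⟩ c
≤-≼-trans a≤b (scaled b≤κc) = scaled (≤-trans a≤b b≤κc)

≼-+ : ∀ {a b c κ μ} → a ≼⟨ κ ⟩ c → b ≼⟨ μ ⟩ c → a + b ≼⟨ κ + μ ⟩ c
≼-+ {c = c} {κ} {μ} (scaled a≤κc) (scaled b≤μc) =
  scaled (subst (_ ≤_) (sym (*-distribʳ-+ c κ μ)) (+-mono-≤ a≤κc b≤μc))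

≼-* : ∀ {a₁ b₁ κ₁ a₂ b₂ κ₂} → 0ℚ ≤ a₁ → a₁ ≼⟨ κ₁ ⟩ b₁ → 0ℚ ≤ a₂ → a₂ ≼⟨ κ₂ ⟩ b₂ →
      a₁ * a₂ ≼⟨ κ₁ * κ₂ ⟩ b₁ * b₂
≼-* {a₁} {b₁} {κ₁} {a₂} {b₂} {κ₂} 0≤a₁ (scaled a₁≤) 0≤a₂ (scaled a₂≤) =
  scaled (subst (a₁ * a₂ ≤_) (regroup κ₁ b₁ κ₂ b₂) (*-mono-≤-nonNeg 0≤a₁ a₁≤ 0≤a₂ a₂≤))
  where
  regroup : ∀ κ₁ b₁ κ₂ b₂ → (κ₁ * b₁) * (κ₂ * b₂) ≡ (κ₁ * κ₂) * (b₁ * b₂)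
  regroup = solve-∀ ℚ-ring

rescale : ∀ {a b} β κ .{{_ : ℚ.NonNegative κ}} → κ * β ≡ 1ℚ → β * a ≤ b → a ≼⟨ κ ⟩ b
rescale {a} {b} β κ κβ≡1 βa≤b = scaled (subst (_≤ κ * b) κβa≡a (*-monoˡ-≤-nonNeg κ βa≤b))
  where
  κβa≡a : κ * (β * a) ≡ a
  κβa≡a = trans (sym (*-assoc κ β a)) (trans (cong (_* a) κβ≡1) (*-identityˡ a))

shrink : ∀ {a b d δ} κ .{{_ : ℚ.NonNegative κ}} → κ * (1ℚ - δ) ≡ 1ℚ → a ≤ b + d → d ≼⟨ δ ⟩ a → a ≼⟨ κ ⟩ b
shrink {a} {b} {d} {δ} κ κ[1-δ]≡1 a≤b+d (scaled d≤δa) = rescale (1ℚ - δ) κ κ[1-δ]≡1 [1-δ]a≤b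
  where
  slack≡ : ∀ a b d δ → (b + d - a) + (δ * a - d) ≡ b - (1ℚ - δ) * a
  slack≡ = solve-∀ ℚ-ring
  [1-δ]a≤b : (1ℚ - δ) * a ≤ b
  [1-δ]a≤b = 0≤q-p⇒p≤q (subst (0ℚ ≤_) (slack≡ a b d δ) (+-mono-≤ (0≤q-p a≤b+d) (0≤q-p d≤δa)))

∑ : ∀ {A : Set} → List A → (A → ℚ) → ℚ
∑ xs f = foldr _+_ 0ℚ (map f xs)

infix 5 ∑
syntax ∑ xs (λ x → e) = ∑[ x ∈ xs ] e

∑-cong : ∀ (xs : List A) {f g : A → ℚ} → (∀ x → f x ≡ g x) → ∑ xs f ≡ ∑ xs g
∑-cong []       f≗g = refl
∑-cong (x ∷ xs) f≗g = cong₂ _+_ (f≗g x) (∑-cong xs f≗g)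

∑-cong-All : ∀ {xs : List A} {f g : A → ℚ} → All (λ x → f x ≡ g x) xs → ∑ xs f ≡ ∑ xs g
∑-cong-All []             = refl
∑-cong-All (fx≡gx ∷ f≡g) = cong₂ _+_ fx≡gx (∑-cong-All f≡g)

∑-++ : ∀ (xs ys : List A) (f : A → ℚ) → ∑ (xs ++ ys) f ≡ ∑ xs f + ∑ ys f
∑-++ []       ys f = sym (+-identityˡ (∑ ys f))
∑-++ (x ∷ xs) ys f = trans (cong (_+_ (f x)) (∑-++ xs ys f)) (sym (+-assoc (f x) (∑ xs f) (∑ ys f)))

∑-map : ∀ (g : A → B) (xs : List A) (f : B → ℚ) → ∑ (map g xs) f ≡ ∑ xs (f ∘ g)
∑-map g xs f = cong (foldr _+_ 0ℚ) (sym (List.map-∘ xs))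

∑-concatMap : ∀ (g : A → List B) (xs : List A) (f : B → ℚ) → ∑ (concatMap g xs) f ≡ ∑[ x ∈ xs ] ∑ (g x) f
∑-concatMap g []       f = refl
∑-concatMap g (x ∷ xs) f = trans (∑-++ (g x) (concatMap g xs) f) (cong (_+_ (∑ (g x) f)) (∑-concatMap g xs f))

∑-+ : ∀ (xs : List A) (f g : A → ℚ) → ∑[ x ∈ xs ] (f x + g x) ≡ ∑ xs f + ∑ xs g
∑-+ []       f g = refl
∑-+ (x ∷ xs) f g = trans (cong (_+_ (f x + g x)) (∑-+ xs f g)) (regroup (f x) (g x) (∑ xs f) (∑ xs g))
  where
  regroup : ∀ a b c d → a + b + (c + d) ≡ (a + c) + (b + d)
  regroup = solve-∀ ℚ-ring

∑-*ˡ : ∀ (xs : List A) (c : ℚ) (f : A → ℚ) → ∑[ x ∈ xs ] c * f x ≡ c * ∑ xs f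
∑-*ˡ []       c f = sym (*-zeroʳ c)
∑-*ˡ (x ∷ xs) c f = trans (cong (_+_ (c * f x)) (∑-*ˡ xs c f)) (sym (*-distribˡ-+ c (f x) (∑ xs f)))

∑-zero : ∀ (xs : List A) → ∑[ x ∈ xs ] 0ℚ ≡ 0ℚ
∑-zero []       = refl
∑-zero (x ∷ xs) = trans (+-identityˡ (∑[ x ∈ xs ] 0ℚ)) (∑-zero xs)

∑-nonNeg : ∀ (xs : List A) {f : A → ℚ} → (∀ x → 0ℚ ≤ f x) → 0ℚ ≤ ∑ xs f
∑-nonNeg []       0≤f = ≤-refl
∑-nonNeg (x ∷ xs) 0≤f = +-mono-≤ (0≤f x) (∑-nonNeg xs 0≤f)

δ : ∀ {n} → Fin n → Fin n → ℚ
δ x y = if x == y then 1ℚ else 0ℚ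

∑-δ : ∀ {n} (x : Fin n) (f : Fin n → ℚ) → ∑[ v ∈ allFin n ] δ x v * f v ≡ f x
∑-δ {suc n} x f = trans (cong (_+_ (δ x Fin.zero * f Fin.zero)) ∑-suc) (by-cases x)
  where
  open ≡-Reasoning
  ∑-suc : ∑ (tabulate Fin.suc) (λ v → δ x v * f v) ≡ ∑[ v ∈ allFin n ] δ x (Fin.suc v) * f (Fin.suc v)
  ∑-suc = trans (cong (λ vs → ∑ vs (λ v → δ x v * f v)) (sym (List.map-tabulate id Fin.suc)))
                (∑-map Fin.suc (allFin n) (λ v → δ x v * f v))
  by-cases : ∀ x → δ x Fin.zero * f Fin.zero + (∑[ v ∈ allFin n ] δ x (Fin.suc v) * f (Fin.suc v)) ≡ f x
  by-cases Fin.zero = begin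
    1ℚ * f Fin.zero + (∑[ v ∈ allFin n ] 0ℚ * f (Fin.suc v))
      ≡⟨ cong₂ _+_ (*-identityˡ (f Fin.zero)) (∑-*ˡ (allFin n) 0ℚ (f ∘ Fin.suc)) ⟩
    f Fin.zero + 0ℚ * ∑ (allFin n) (f ∘ Fin.suc)
      ≡⟨ cong (_+_ (f Fin.zero)) (*-zeroˡ (∑ (allFin n) (f ∘ Fin.suc))) ⟩
    f Fin.zero + 0ℚ
      ≡⟨ +-identityʳ (f Fin.zero) ⟩
    f Fin.zero ∎
  by-cases (Fin.suc x) = begin
    0ℚ * f Fin.zero + (∑[ v ∈ allFin n ] δ x v * f (Fin.suc v))   ≡⟨ cong₂ _+_ (*-zeroˡ (f Fin.zero)) (∑-δ x (f ∘ Fin.suc)) ⟩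
    0ℚ + f (Fin.suc x)                                           ≡⟨ +-identityˡ (f (Fin.suc x)) ⟩
    f (Fin.suc x)                                                ∎

take-suc-drop : ∀ i (X : List A) → take (suc i) X ≡ take i X ++ take 1 (drop i X)
take-suc-drop zero    X        = refl
take-suc-drop (suc i) []       = refl
take-suc-drop (suc i) (x ∷ X) = cong (x ∷_) (take-suc-drop i X)

take-suc-++-↭ : ∀ i j (X Y : List A) → take (suc i) X ++ take j Y ↭ (take i X ++ take j Y) ++ take 1 (drop i X)
take-suc-++-↭ i j X Y = begin
  take (suc i) X ++ take j Y               ≡⟨ cong (_++ take j Y) (take-suc-drop i X) ⟩
  (take i X ++ take 1 (drop i X)) ++ take j Y
                                           ≡⟨ List.++-assoc (take i X) (take 1 (drop i X)) (take j Y) ⟩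
  take i X ++ (take 1 (drop i X) ++ take j Y)
                                           ↭⟨ ↭.++⁺ˡ (take i X) (↭.++-comm (take 1 (drop i X)) (take j Y)) ⟩
  take i X ++ (take j Y ++ take 1 (drop i X))
                                           ≡⟨ List.++-assoc (take i X) (take j Y) (take 1 (drop i X)) ⟨
  (take i X ++ take j Y) ++ take 1 (drop i X) ∎
  where open PermutationReasoning

++-take-suc : ∀ i j (X Y : List A) → take i X ++ take (suc j) Y ≡ (take i X ++ take j Y) ++ take 1 (drop j Y)
++-take-suc i j X Y = trans (cong (take i X ++_) (take-suc-drop j Y)) (sym (List.++-assoc (take i X) (take j Y) (take 1 (drop j Y))))

drop-suc : ∀ i (X : List A) {x Xr} → drop i X ≡ x ∷ Xr → drop (suc i) X ≡ Xr
drop-suc zero    (x ∷ X) refl = refl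
drop-suc (suc i) (y ∷ X) eq   = drop-suc i X eq

all-↭ : ∀ (p : A → Bool) {xs ys} → xs ↭ ys → all p xs ≡ all p ys
all-↭ p xs↭ys = ↭ₛ.foldr-commMonoid (setoid Bool) ∧-isCommutativeMonoid (↭⇒↭ₛ (↭.map⁺ p xs↭ys))

all-++ : ∀ (p : A → Bool) xs ys → all p (xs ++ ys) ≡ all p xs ∧ all p ys
all-++ p []       ys = refl
all-++ p (x ∷ xs) ys = trans (cong (p x ∧_) (all-++ p xs ys)) (sym (∧-assoc (p x) (all p xs) (all p ys)))

all-true : ∀ {A : Set} {p : A → Bool} {xs} → All (λ x → p x ≡ true) xs → all p xs ≡ true
all-true []            = refl
all-true (px ∷ pxs) rewrite px = all-true pxs

AllPairs-++-between : ∀ {A : Set} {R : A → A → Set} {xs ys} → AllPairs R (xs ++ ys) → All (λ x → All (R x) ys) xs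
AllPairs-++-between {xs = []}     _            = []
AllPairs-++-between {xs = x ∷ xs} (Rx ∷ Rxsys) = All.++⁻ʳ xs Rx ∷ AllPairs-++-between Rxsys

sum-map-mono : ∀ (xs : List A) {f g : A → ℕ} → (∀ x → f x ℕ.≤ g x) → sum (map f xs) ℕ.≤ sum (map g xs)
sum-map-mono []       f≤g = z≤n
sum-map-mono (x ∷ xs) f≤g = ℕ.+-mono-≤ (f≤g x) (sum-map-mono xs f≤g)

sum-map-+ : ∀ (xs : List A) (f g : A → ℕ) → sum (map (λ x → f x ℕ.+ g x) xs) ≡ sum (map f xs) ℕ.+ sum (map g xs)
sum-map-+ []       f g = refl
sum-map-+ (x ∷ xs) f g = trans (cong (f x ℕ.+ g x ℕ.+_) (sum-map-+ xs f g)) (regroup (f x) (g x) _ _)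
  where
  regroup : ∀ a b c d → a ℕ.+ b ℕ.+ (c ℕ.+ d) ≡ (a ℕ.+ c) ℕ.+ (b ℕ.+ d)
  regroup = ℕ-Solver.solve-∀

AllPairs-tabulate⁻ : ∀ {A : Set} {R : A → A → Set} → (∀ {x y} → R x y → R y x) →
  ∀ {l} {f : Fin l → A} → AllPairs R (tabulate f) → ∀ {i j} → i ≢ j → R (f i) (f j)
AllPairs-tabulate⁻ R-sym {suc l} (Rf₀ ∷ Rf) {Fin.zero}  {Fin.zero}  0≢0 = ⊥-elim (0≢0 refl)
AllPairs-tabulate⁻ R-sym {suc l} (Rf₀ ∷ Rf) {Fin.zero}  {Fin.suc j} _   = All.tabulate⁻ Rf₀ j
AllPairs-tabulate⁻ R-sym {suc l} (Rf₀ ∷ Rf) {Fin.suc i} {Fin.zero}  _   = R-sym (All.tabulate⁻ Rf₀ i)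
AllPairs-tabulate⁻ R-sym {suc l} (Rf₀ ∷ Rf) {Fin.suc i} {Fin.suc j} i≢j = AllPairs-tabulate⁻ R-sym Rf (i≢j ∘ cong Fin.suc)

-- Interleavings and the shuffle identity

latticePaths : ℕ → ℕ → List (List Bool)
latticePaths zero    j       = [ replicate j false ]
latticePaths (suc i) zero    = [ replicate (suc i) true ]
latticePaths (suc i) (suc j) =
  map (true ∷_) (latticePaths i (suc j)) ++ map (false ∷_) (latticePaths (suc i) j)

interleave : List Bool → List A → List A → List A
interleave (true  ∷ π) (x ∷ xs) ys       = x ∷ interleave π xs ys
interleave (false ∷ π) xs       (y ∷ ys) = y ∷ interleave π xs ys
interleave _           _        _        = []

Fits : List Bool → List A → List A → Set
Fits []          []       []       = ⊤
Fits (true  ∷ π) (x ∷ xs) ys       = Fits π xs ys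
Fits (false ∷ π) xs       (y ∷ ys) = Fits π xs ys
Fits _           _        _        = ⊥

latticePaths-fit : ∀ (xs ys : List A) → All (λ π → Fits π xs ys) (latticePaths (length xs) (length ys))
latticePaths-fit []       ys       = fit ys ∷ []
  where
  fit : ∀ ys → Fits (replicate (length ys) false) [] ys
  fit []       = tt
  fit (y ∷ ys) = fit ys
latticePaths-fit (x ∷ xs) []       = fit (x ∷ xs) ∷ []
  where
  fit : ∀ xs → Fits (replicate (length xs) true) xs []
  fit []       = tt
  fit (x ∷ xs) = fit xs
latticePaths-fit (x ∷ xs) (y ∷ ys) =
  All.++⁺ (All.map⁺ (latticePaths-fit xs (y ∷ ys))) (All.map⁺ (latticePaths-fit (x ∷ xs) ys))

interleave-↭ : ∀ π (xs ys : List A) → Fits π xs ys → interleave π xs ys ↭ xs ++ ys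
interleave-↭ []          []       []       _   = ↭-refl
interleave-↭ (true  ∷ π) (x ∷ xs) ys       fit = prep x (interleave-↭ π xs ys fit)
interleave-↭ (false ∷ π) xs       (y ∷ ys) fit = ↭-trans (prep y (interleave-↭ π xs ys fit)) (↭-sym (↭.shift y xs ys))

words : ∀ {n} → ℕ → List (List (Fin n))
words     zero    = [ [] ]
words {n} (suc k) = concatMap (λ v → map (v ∷_) (words k)) (allFin n)

∑-words-suc : ∀ {n} k (f : List (Fin n) → ℚ) → ∑ (words (suc k)) f ≡ ∑[ v ∈ allFin n ] ∑[ l ∈ words k ] f (v ∷ l)
∑-words-suc {n} k f = trans (∑-concatMap (λ v → map (v ∷_) (words k)) (allFin n) f)
                            (∑-cong (allFin n) (λ v → ∑-map (v ∷_) (words k) f))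

∑-allTuples : ∀ {n} k (f : List (Fin n) → ℚ) → ∑[ K ∈ allTuples k ] f (VF.toList K) ≡ ∑ (words k) f
∑-allTuples     zero    f = refl
∑-allTuples {n} (suc k) f = begin
  ∑[ K ∈ allTuples (suc k) ] f (VF.toList K)
    ≡⟨ ∑-concatMap (λ v → map (v VF.∷_) (allTuples k)) (allFin n) (f ∘ VF.toList) ⟩
  ∑[ v ∈ allFin n ] ∑ (map (v VF.∷_) (allTuples k)) (f ∘ VF.toList)
    ≡⟨ ∑-cong (allFin n) (λ v → trans (∑-map (v VF.∷_) (allTuples k) (f ∘ VF.toList)) (∑-allTuples k (f ∘ (v ∷_)))) ⟩
  ∑[ v ∈ allFin n ] ∑[ l ∈ words k ] f (v ∷ l)
    ≡⟨ ∑-words-suc k f ⟨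
  ∑ (words (suc k)) f ∎
  where open ≡-Reasoning

embeddings : ∀ {n} → List (Fin n) → List (Fin n) → ℚ
embeddings []       ys       = 1ℚ
embeddings (x ∷ xs) []       = 0ℚ
embeddings (x ∷ xs) (y ∷ ys) = δ x y * embeddings xs ys + embeddings (x ∷ xs) ys

latticePaths-0 : ∀ i → latticePaths i 0 ≡ [ replicate i true ]
latticePaths-0 zero    = refl
latticePaths-0 (suc i) = refl

∑-words-interleave-[] : ∀ {n} k (g : List (Fin n) → ℚ) →
  ∑ (words k) g ≡ ∑[ e ∈ words k ] g (interleave (replicate k false) [] e)
∑-words-interleave-[]     zero    g = refl
∑-words-interleave-[] {n} (suc k) g = begin
  ∑ (words (suc k)) g
    ≡⟨ ∑-words-suc k g ⟩
  ∑[ v ∈ allFin n ] ∑[ l ∈ words k ] g (v ∷ l)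
    ≡⟨ ∑-cong (allFin n) (λ v → ∑-words-interleave-[] k (g ∘ (v ∷_))) ⟩
  ∑[ v ∈ allFin n ] ∑[ l ∈ words k ] g (v ∷ interleave (replicate k false) [] l)
    ≡⟨ ∑-words-suc k (λ e → g (interleave (replicate (suc k) false) [] e)) ⟨
  ∑[ e ∈ words (suc k) ] g (interleave (replicate (suc k) false) [] e) ∎
  where open ≡-Reasoning

∑-embeddings-∷ : ∀ {n} (x : Fin n) xs k (g : List (Fin n) → ℚ) →
  ∑[ l ∈ words (suc k) ] embeddings (x ∷ xs) l * g l
  ≡ (∑[ l ∈ words k ] embeddings xs l * g (x ∷ l)) + (∑[ v ∈ allFin n ] ∑[ l ∈ words k ] embeddings (x ∷ xs) l * g (v ∷ l))
∑-embeddings-∷ {n} x xs k g = begin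
  ∑[ l ∈ words (suc k) ] embeddings (x ∷ xs) l * g l     ≡⟨ ∑-words-suc k (λ l → embeddings (x ∷ xs) l * g l) ⟩
  ∑[ v ∈ allFin n ] ∑[ l ∈ words k ] embeddings (x ∷ xs) (v ∷ l) * g (v ∷ l)
                                                         ≡⟨ ∑-cong (allFin n) first-letter ⟩
  ∑[ v ∈ allFin n ] (δ x v * matched v + skipped v)      ≡⟨ ∑-+ (allFin n) (λ v → δ x v * matched v) skipped ⟩
  (∑[ v ∈ allFin n ] δ x v * matched v) + ∑ (allFin n) skipped
                                                         ≡⟨ cong (_+ ∑ (allFin n) skipped) (∑-δ x matched) ⟩
  matched x + ∑ (allFin n) skipped                       ∎
  where
  open ≡-Reasoning
  matched skipped : Fin n → ℚ
  matched v = ∑[ l ∈ words k ] embeddings xs l * g (v ∷ l)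
  skipped v = ∑[ l ∈ words k ] embeddings (x ∷ xs) l * g (v ∷ l)
  distrib : ∀ a b c d → (a * b + c) * d ≡ a * (b * d) + c * d
  distrib = solve-∀ ℚ-ring
  first-letter : ∀ v → ∑[ l ∈ words k ] embeddings (x ∷ xs) (v ∷ l) * g (v ∷ l) ≡ δ x v * matched v + skipped v
  first-letter v = begin
    ∑[ l ∈ words k ] (δ x v * embeddings xs l + embeddings (x ∷ xs) l) * g (v ∷ l)
      ≡⟨ ∑-cong (words k) (λ l → distrib (δ x v) (embeddings xs l) (embeddings (x ∷ xs) l) (g (v ∷ l))) ⟩
    ∑[ l ∈ words k ] (δ x v * (embeddings xs l * g (v ∷ l)) + embeddings (x ∷ xs) l * g (v ∷ l))
      ≡⟨ ∑-+ (words k) (λ l → δ x v * (embeddings xs l * g (v ∷ l))) (λ l → embeddings (x ∷ xs) l * g (v ∷ l)) ⟩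
    (∑[ l ∈ words k ] δ x v * (embeddings xs l * g (v ∷ l))) + skipped v
      ≡⟨ cong (_+ skipped v) (∑-*ˡ (words k) (δ x v) (λ l → embeddings xs l * g (v ∷ l))) ⟩
    δ x v * matched v + skipped v ∎

∑-embeddings-short : ∀ {n} (xs : List (Fin n)) k → k ℕ.< length xs → (g : List (Fin n) → ℚ) →
  ∑[ l ∈ words k ] embeddings xs l * g l ≡ 0ℚ
∑-embeddings-short     (x ∷ xs) zero    _         g = trans (cong (_+ 0ℚ) (*-zeroˡ (g []))) (+-identityʳ 0ℚ)
∑-embeddings-short {n} (x ∷ xs) (suc k) (s≤s k<∣xs∣) g = begin
  ∑[ l ∈ words (suc k) ] embeddings (x ∷ xs) l * g l
    ≡⟨ ∑-embeddings-∷ x xs k g ⟩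
  (∑[ l ∈ words k ] embeddings xs l * g (x ∷ l)) + (∑[ v ∈ allFin n ] ∑[ l ∈ words k ] embeddings (x ∷ xs) l * g (v ∷ l))
    ≡⟨ cong₂ _+_ (∑-embeddings-short xs k k<∣xs∣ (g ∘ (x ∷_)))
                 (∑-cong (allFin n) (λ v → ∑-embeddings-short (x ∷ xs) k (ℕ.m<n⇒m<1+n k<∣xs∣) (g ∘ (v ∷_)))) ⟩
  0ℚ + (∑[ v ∈ allFin n ] 0ℚ)
    ≡⟨ cong (_+_ (0ℚ)) (∑-zero (allFin n)) ⟩
  0ℚ ∎
  where open ≡-Reasoning

∑-embeddings : ∀ {n} (xs : List (Fin n)) k m → k ≡ length xs ℕ.+ m → (g : List (Fin n) → ℚ) →
  ∑[ l ∈ words k ] embeddings xs l * g l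
  ≡ ∑[ e ∈ words m ] ∑[ π ∈ latticePaths (length xs) m ] g (interleave π xs e)
∑-embeddings [] k .k refl g = begin
  ∑[ l ∈ words k ] 1ℚ * g l
    ≡⟨ ∑-cong (words k) (λ l → *-identityˡ (g l)) ⟩
  ∑ (words k) g
    ≡⟨ ∑-words-interleave-[] k g ⟩
  ∑[ e ∈ words k ] g (interleave (replicate k false) [] e)
    ≡⟨ ∑-cong (words k) (λ e → sym (+-identityʳ (g (interleave (replicate k false) [] e)))) ⟩
  ∑[ e ∈ words k ] ∑[ π ∈ latticePaths 0 k ] g (interleave π [] e) ∎
  where open ≡-Reasoning
∑-embeddings {n} (x ∷ xs) (suc k) zero eq g = begin
  ∑[ l ∈ words (suc k) ] embeddings (x ∷ xs) l * g l
    ≡⟨ ∑-embeddings-∷ x xs k g ⟩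
  (∑[ l ∈ words k ] embeddings xs l * g (x ∷ l)) + (∑[ v ∈ allFin n ] ∑[ l ∈ words k ] embeddings (x ∷ xs) l * g (v ∷ l))
    ≡⟨ cong₂ _+_ (∑-embeddings xs k 0 k≡ (g ∘ (x ∷_)))
                 (trans (∑-cong (allFin n) (λ v → ∑-embeddings-short (x ∷ xs) k k<∣x∷xs∣ (g ∘ (v ∷_)))) (∑-zero (allFin n))) ⟩
  (∑[ e ∈ words 0 ] ∑[ π ∈ latticePaths (length xs) 0 ] g (x ∷ interleave π xs e)) + 0ℚ
    ≡⟨ +-identityʳ (∑[ e ∈ words 0 ] ∑[ π ∈ latticePaths (length xs) 0 ] g (x ∷ interleave π xs e)) ⟩
  ∑[ e ∈ words 0 ] ∑[ π ∈ latticePaths (length xs) 0 ] g (x ∷ interleave π xs e)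
    ≡⟨ cong (λ πs → ∑[ e ∈ words 0 ] ∑[ π ∈ πs ] g (x ∷ interleave π xs e)) (latticePaths-0 (length xs)) ⟩
  ∑[ e ∈ words 0 ] ∑[ π ∈ latticePaths (suc (length xs)) 0 ] g (interleave π (x ∷ xs) e) ∎
  where
  open ≡-Reasoning
  k≡ : k ≡ length xs ℕ.+ 0
  k≡ = ℕ.suc-injective eq
  k<∣x∷xs∣ : k ℕ.< length (x ∷ xs)
  k<∣x∷xs∣ = s≤s (ℕ.≤-reflexive (trans k≡ (ℕ.+-identityʳ (length xs))))
∑-embeddings {n} (x ∷ xs) (suc k) (suc m) eq g = begin
  ∑[ l ∈ words (suc k) ] embeddings (x ∷ xs) l * g l
    ≡⟨ ∑-embeddings-∷ x xs k g ⟩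
  (∑[ l ∈ words k ] embeddings xs l * g (x ∷ l)) + (∑[ v ∈ allFin n ] ∑[ l ∈ words k ] embeddings (x ∷ xs) l * g (v ∷ l))
    ≡⟨ cong₂ _+_ (∑-embeddings xs k (suc m) (ℕ.suc-injective eq) (g ∘ (x ∷_)))
                 (trans (∑-cong (allFin n) (λ v → ∑-embeddings (x ∷ xs) k m k≡ (g ∘ (v ∷_))))
                        (sym (∑-words-suc m viaFalse))) ⟩
  ∑ (words (suc m)) viaTrue + ∑ (words (suc m)) viaFalse
    ≡⟨ ∑-+ (words (suc m)) viaTrue viaFalse ⟨
  ∑[ e ∈ words (suc m) ] (viaTrue e + viaFalse e)
    ≡⟨ ∑-cong (words (suc m)) (λ e → sym (split e)) ⟩
  ∑[ e ∈ words (suc m) ] ∑[ π ∈ latticePaths (suc (length xs)) (suc m) ] g (interleave π (x ∷ xs) e) ∎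
  where
  open ≡-Reasoning
  k≡ : k ≡ length (x ∷ xs) ℕ.+ m
  k≡ = trans (ℕ.suc-injective eq) (ℕ.+-suc (length xs) m)
  viaTrue viaFalse : List (Fin n) → ℚ
  viaTrue  e = ∑[ π ∈ latticePaths (length xs) (suc m) ] g (interleave (true ∷ π) (x ∷ xs) e)
  viaFalse e = ∑[ π ∈ latticePaths (suc (length xs)) m ] g (interleave (false ∷ π) (x ∷ xs) e)
  split : ∀ e → ∑[ π ∈ latticePaths (suc (length xs)) (suc m) ] g (interleave π (x ∷ xs) e) ≡ viaTrue e + viaFalse e
  split e = trans (∑-++ (map (true ∷_) (latticePaths (length xs) (suc m))) (map (false ∷_) (latticePaths (suc (length xs)) m)) h)
                  (cong₂ _+_ (∑-map (true ∷_) (latticePaths (length xs) (suc m)) h) (∑-map (false ∷_) (latticePaths (suc (length xs)) m) h))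
    where
    h : List Bool → ℚ
    h π = g (interleave π (x ∷ xs) e)

-- The inequality for a grid of counts

-- The properties of c i j = |N(first i vertices of X, first j vertices of Y)| in a graph on
-- n vertices of minimum degree at least 31n/33 (see `neighbourhoodGrid-countGrid`).
record CountGrid (n : ℕ) (c : ℕ → ℕ → ℕ) : Set where
  field
    origin       : c 0 0 ≡ n
    antitoneˡ    : ∀ i j → c (suc i) j ℕ.≤ c i j
    antitoneʳ    : ∀ i j → c i (suc j) ℕ.≤ c i j
    lossˡ        : ∀ i j → 33 ℕ.* c i j ℕ.≤ 33 ℕ.* c (suc i) j ℕ.+ 2 ℕ.* n
    lossʳ        : ∀ i j → 33 ℕ.* c i j ℕ.≤ 33 ℕ.* c i (suc j) ℕ.+ 2 ℕ.* n
    supermodular : ∀ i j → c (suc i) j ℕ.+ c i (suc j) ℕ.≤ c i j ℕ.+ c (suc i) (suc j)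

weightAlong : (ℕ → ℕ → ℕ) → ℕ → ℕ → List Bool → ℚ
weightAlong c i j []            = 1ℚ
weightAlong c i j (true  ∷ π) = invℕ (c (suc i) j) * weightAlong c (suc i) j π
weightAlong c i j (false ∷ π) = invℕ (c i (suc j)) * weightAlong c i (suc j) π

-- W(v₁,…,v₅) along a path: the points reached after steps 2 to 5.
pathWeight : (ℕ → ℕ → ℕ) → List Bool → ℚ
pathWeight c []            = 1ℚ
pathWeight c (true  ∷ π) = weightAlong c 1 0 (take 4 π)
pathWeight c (false ∷ π) = weightAlong c 0 1 (take 4 π)

pathψ : List Bool → ℚ
pathψ (true  ∷ true  ∷ _) = + 1 / 6
pathψ (true  ∷ false ∷ _) = -[1+ 0 ] / 6
pathψ (false ∷ true  ∷ _) = -[1+ 0 ] / 6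
pathψ (false ∷ false ∷ _) = + 1 / 2
pathψ _                   = 0ℚ

pathSum : (ℕ → ℕ → ℕ) → ℚ
pathSum c = ∑[ π ∈ latticePaths 4 2 ] pathWeight c π * pathψ π

-- The left-hand side is `pathSum` unfolded, with Up, Uq, Us, Ut, Um, Uh, Uw, Uz, Uy, Uv, Uo
-- standing for 1/c at (2,0), (1,1), (0,2), (3,0), (2,1), (1,2), (4,0), (3,1), (2,2), (4,1),
-- (3,2), r for 2n/33 and L for c(1,0) − c(2,0).  For a count grid every bracket on the right
-- is nonnegative, and the last coefficient is what remains of 1/6 after the six ratio bounds:
-- 1/6 − (1/69 + 1/75 + 2/69 + 2/75 + 841/15525 + 29/1863).
pathSum-certificate : ∀ r L Up Uq Us Ut Um Uh Uw Uz Uy Uv Uo →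
    Up * (Ut * (Uw * (Uv * 1ℚ))) * (+ 1 / 6)
  + (Up * (Ut * (Uz * (Uv * 1ℚ))) * (+ 1 / 6)
  + (Up * (Ut * (Uz * (Uo * 1ℚ))) * (+ 1 / 6)
  + (Up * (Um * (Uz * (Uv * 1ℚ))) * (+ 1 / 6)
  + (Up * (Um * (Uz * (Uo * 1ℚ))) * (+ 1 / 6)
  + (Up * (Um * (Uy * (Uo * 1ℚ))) * (+ 1 / 6)
  + (Uq * (Um * (Uz * (Uv * 1ℚ))) * (-[1+ 0 ] / 6)
  + (Uq * (Um * (Uz * (Uo * 1ℚ))) * (-[1+ 0 ] / 6)
  + (Uq * (Um * (Uy * (Uo * 1ℚ))) * (-[1+ 0 ] / 6)
  + (Uq * (Uh * (Uy * (Uo * 1ℚ))) * (-[1+ 0 ] / 6)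
  + (Uq * (Um * (Uz * (Uv * 1ℚ))) * (-[1+ 0 ] / 6)
  + (Uq * (Um * (Uz * (Uo * 1ℚ))) * (-[1+ 0 ] / 6)
  + (Uq * (Um * (Uy * (Uo * 1ℚ))) * (-[1+ 0 ] / 6)
  + (Uq * (Uh * (Uy * (Uo * 1ℚ))) * (-[1+ 0 ] / 6)
  + (Us * (Uh * (Uy * (Uo * 1ℚ))) * (+ 1 / 2)
  + 0ℚ))))))))))))))
  ≡ + 1 / 6 * (Up * Uz * (Uo + Uv) * (Ut - Um + r * (Ut * Um)))
  + + 1 / 3 * (Um * Uz * (Uo + Uv) * (Up - Uq + (r - L) * (Up * Uq)))
  + + 1 / 6 * (Uq * Uy * Uo * (Uh - Um + L * (Uh * Um)))
  + + 1 / 2 * (Uh * Uy * Uo * (Us - Uq + r * (Us * Uq)))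
  + + 1 / 6 * (Um * Uy * Uo * (Up - Uq + (r - L) * (Up * Uq)))
  + + 1 / 6 * (L * Um * Uq * Uo * (+ 2 / 1 * (Up * Uz) - Uh * Uy))
  + + 1 / 3 * (L * Um * Up * Uq * Uz * Uv)
  + + 1 / 6 * (L * Um * Up * Uq * Uy * Uo)
  + + 1 / 6 * (Up * Ut * (+ 2 / 23 * (Uw * Uv) - r * (Um * (Uz * Uo))))
  + + 1 / 6 * (Up * Ut * Uv * (+ 2 / 25 * Uw - r * (Um * Uz)))
  + + 1 / 3 * (Up * (+ 2 / 23 * (Ut * (Uw * Uv)) - r * (Uq * (Um * (Uz * Uo)))))
  + + 1 / 3 * (Up * Uv * (+ 2 / 25 * (Ut * Uw) - r * (Uq * (Um * Uz))))
  + + 1 / 2 * (+ 1682 / 15525 * (Up * (Ut * (Uw * Uv))) - r * (Us * (Uq * (Uh * (Uy * Uo)))))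
  + + 1 / 6 * (Up * (+ 58 / 621 * (Ut * (Uw * Uv)) - r * (Uq * (Um * (Uy * Uo)))))
  + + 1253 / 93150 * (Up * Ut * Uw * Uv)
pathSum-certificate = solve-∀ ℚ-ring

≤-+-*-step : ∀ {m a b k d} → m ℕ.≤ a ℕ.+ k ℕ.* d → a ℕ.≤ b ℕ.+ d → m ℕ.≤ b ℕ.+ suc k ℕ.* d
≤-+-*-step {b = b} {k} {d} m≤a+kd a≤b+d =
  ℕ.≤-trans m≤a+kd (ℕ.≤-trans (ℕ.+-monoˡ-≤ (k ℕ.* d) a≤b+d) (ℕ.≤-reflexive (ℕ.+-assoc b d (k ℕ.* d))))

module _ {n : ℕ} {c : ℕ → ℕ → ℕ} (grid : CountGrid (suc n) c) where
  open CountGrid grid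

  private
    N r : ℚ
    N = fromℕ (suc n)
    r = + 2 / 33 * N

    x u : ℕ → ℕ → ℚ
    x i j = fromℕ (c i j)
    u i j = invℕ (c i j)

    lowerℕ : ∀ i j → 33 ℕ.* suc n ℕ.≤ 33 ℕ.* c i j ℕ.+ (i ℕ.+ j) ℕ.* (2 ℕ.* suc n)
    lowerℕ zero    zero    = ℕ.≤-reflexive (trans (cong (33 ℕ.*_) (sym origin)) (sym (ℕ.+-identityʳ _)))
    lowerℕ (suc i) j       = ≤-+-*-step {k = i ℕ.+ j} {2 ℕ.* suc n} (lowerℕ i j) (lossˡ i j)
    lowerℕ zero    (suc j) = ≤-+-*-step {k = j} {2 ℕ.* suc n} (lowerℕ zero j) (lossʳ zero j)

    upperℕ : ∀ i j → c i j ℕ.≤ suc n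
    upperℕ zero    zero    = ℕ.≤-reflexive origin
    upperℕ (suc i) j       = ℕ.≤-trans (antitoneˡ i j) (upperℕ i j)
    upperℕ zero    (suc j) = ℕ.≤-trans (antitoneʳ zero j) (upperℕ zero j)

    nonzero : ∀ i j → i ℕ.+ j ℕ.≤ 16 → c i j ≢ 0
    nonzero i j k≤16 c≡0 = ℕ.<-irrefl refl (ℕ.<-≤-trans (ℕ.m<n+m (32 ℕ.* suc n) (s≤s z≤n)) 33n≤32n)
      where
      33n≤32n : 33 ℕ.* suc n ℕ.≤ 32 ℕ.* suc n
      33n≤32n = begin
        33 ℕ.* suc n                                  ≤⟨ lowerℕ i j ⟩
        33 ℕ.* c i j ℕ.+ (i ℕ.+ j) ℕ.* (2 ℕ.* suc n)  ≡⟨ cong (λ k → 33 ℕ.* k ℕ.+ (i ℕ.+ j) ℕ.* (2 ℕ.* suc n)) c≡0 ⟩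
        (i ℕ.+ j) ℕ.* (2 ℕ.* suc n)                   ≤⟨ ℕ.*-monoˡ-≤ (2 ℕ.* suc n) k≤16 ⟩
        16 ℕ.* (2 ℕ.* suc n)                          ≡⟨ ℕ.*-assoc 16 2 (suc n) ⟨
        32 ℕ.* suc n                                  ∎
        where open ℕ.≤-Reasoning

    reciprocal : ∀ i j {_ : True (i ℕ.+ j ℕ.≤? 16)} → Reciprocal (x i j) (u i j)
    reciprocal i j {k≤16} = record
      { inverse = fromℕ*invℕ≡1 (c i j) (nonzero i j (toWitness k≤16))
      ; nonNeg  = invℕ-nonNeg (c i j)
      }

    lossℚ : ∀ {a b} → 33 ℕ.* a ℕ.≤ 33 ℕ.* b ℕ.+ 2 ℕ.* suc n → fromℕ a ≤ fromℕ b + r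
    lossℚ {a} {b} 33a≤33b+2N = *-cancelˡ-≤-pos (fromℕ 33) (subst₂ _≤_ (fromℕ-* 33 a) cast (fromℕ-mono-≤ 33a≤33b+2N))
      where
      cast : fromℕ (33 ℕ.* b ℕ.+ 2 ℕ.* suc n) ≡ fromℕ 33 * (fromℕ b + + 2 / 33 * N)
      cast = begin
        fromℕ (33 ℕ.* b ℕ.+ 2 ℕ.* suc n)          ≡⟨ fromℕ-+ (33 ℕ.* b) (2 ℕ.* suc n) ⟩
        fromℕ (33 ℕ.* b) + fromℕ (2 ℕ.* suc n)    ≡⟨ cong₂ _+_ (fromℕ-* 33 b) (fromℕ-* 2 (suc n)) ⟩
        fromℕ 33 * fromℕ b + fromℕ 2 * N          ≡⟨ factor (fromℕ b) N ⟩
        fromℕ 33 * (fromℕ b + + 2 / 33 * N)       ∎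
        where
        open ≡-Reasoning
        factor : ∀ B M → fromℕ 33 * B + fromℕ 2 * M ≡ fromℕ 33 * (B + + 2 / 33 * M)
        factor = solve-∀ ℚ-ring

    lowerℚ : ∀ i j → (+ 33 / 2 - fromℕ (i ℕ.+ j)) * r ≤ x i j
    lowerℚ i j = 0≤q-p⇒p≤q (subst (0ℚ ≤_) (slack (x i j) (fromℕ (i ℕ.+ j)) N) (0≤* (nonNegative⁻¹ (+ 1 / 33)) (0≤q-p cast)))
      where
      cast : fromℕ 33 * N ≤ fromℕ 33 * x i j + fromℕ (i ℕ.+ j) * (fromℕ 2 * N)
      cast = subst₂ _≤_ (fromℕ-* 33 (suc n)) rhs≡ (fromℕ-mono-≤ (lowerℕ i j))
        where
        open ≡-Reasoning
        rhs≡ : fromℕ (33 ℕ.* c i j ℕ.+ (i ℕ.+ j) ℕ.* (2 ℕ.* suc n)) ≡ fromℕ 33 * x i j + fromℕ (i ℕ.+ j) * (fromℕ 2 * N)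
        rhs≡ = begin
          fromℕ (33 ℕ.* c i j ℕ.+ (i ℕ.+ j) ℕ.* (2 ℕ.* suc n))        ≡⟨ fromℕ-+ (33 ℕ.* c i j) ((i ℕ.+ j) ℕ.* (2 ℕ.* suc n)) ⟩
          fromℕ (33 ℕ.* c i j) + fromℕ ((i ℕ.+ j) ℕ.* (2 ℕ.* suc n))  ≡⟨ cong₂ _+_ (fromℕ-* 33 (c i j)) (fromℕ-* (i ℕ.+ j) (2 ℕ.* suc n)) ⟩
          fromℕ 33 * x i j + fromℕ (i ℕ.+ j) * fromℕ (2 ℕ.* suc n)    ≡⟨ cong (λ z → fromℕ 33 * x i j + fromℕ (i ℕ.+ j) * z) (fromℕ-* 2 (suc n)) ⟩
          fromℕ 33 * x i j + fromℕ (i ℕ.+ j) * (fromℕ 2 * N)           ∎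
      slack : ∀ X K M → + 1 / 33 * (fromℕ 33 * X + K * (fromℕ 2 * M) - fromℕ 33 * M) ≡ X - (+ 33 / 2 - K) * (+ 2 / 33 * M)
      slack = solve-∀ ℚ-ring

    upperℚ : ∀ i j → x i j ≤ + 33 / 2 * r
    upperℚ i j = subst (x i j ≤_) (N≡ N) (fromℕ-mono-≤ (upperℕ i j))
      where
      N≡ : ∀ M → M ≡ + 33 / 2 * (+ 2 / 33 * M)
      N≡ = solve-∀ ℚ-ring

    antitoneˡℚ : ∀ i j → x (suc i) j ≤ x i j
    antitoneˡℚ i j = fromℕ-mono-≤ (antitoneˡ i j)

    antitoneʳℚ : ∀ i j → x i (suc j) ≤ x i j
    antitoneʳℚ i j = fromℕ-mono-≤ (antitoneʳ i j)

    lossˡℚ : ∀ i j → x i j ≤ x (suc i) j + r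
    lossˡℚ i j = lossℚ {c i j} {c (suc i) j} (lossˡ i j)

    lossʳℚ : ∀ i j → x i j ≤ x i (suc j) + r
    lossʳℚ i j = lossℚ {c i j} {c i (suc j)} (lossʳ i j)

    supermodularℚ : ∀ i j → x (suc i) j + x i (suc j) ≤ x i j + x (suc i) (suc j)
    supermodularℚ i j = subst₂ _≤_ (fromℕ-+ (c (suc i) j) (c i (suc j))) (fromℕ-+ (c i j) (c (suc i) (suc j)))
      (fromℕ-mono-≤ (supermodular i j))

    c₁ p q s t m h w z y v o L : ℚ
    c₁ = x 1 0
    p = x 2 0 ; q = x 1 1 ; s = x 0 2
    t = x 3 0 ; m = x 2 1 ; h = x 1 2
    w = x 4 0 ; z = x 3 1 ; y = x 2 2
    v = x 4 1 ; o = x 3 2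
    L = c₁ - p

    Up Uq Us Ut Um Uh Uw Uz Uy Uv Uo : ℚ
    Up = u 2 0 ; Uq = u 1 1 ; Us = u 0 2
    Ut = u 3 0 ; Um = u 2 1 ; Uh = u 1 2
    Uw = u 4 0 ; Uz = u 3 1 ; Uy = u 2 2
    Uv = u 4 1 ; Uo = u 3 2

    0≤x : ∀ i j → 0ℚ ≤ x i j
    0≤x i j = fromℕ-nonNeg (c i j)

    0≤u : ∀ i j → 0ℚ ≤ u i j
    0≤u i j = invℕ-nonNeg (c i j)

    0≤r : 0ℚ ≤ r
    0≤r = 0≤* (nonNegative⁻¹ (+ 2 / 33)) (fromℕ-nonNeg (suc n))

    0≤L : 0ℚ ≤ L
    0≤L = 0≤q-p (antitoneˡℚ 1 0)

    p≤q+r : p ≤ q + r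
    p≤q+r = ≤-trans (antitoneˡℚ 1 0) (lossʳℚ 1 0)

    gapTM : 0ℚ ≤ Ut - Um + r * (Ut * Um)
    gapTM = reciprocal-gap (reciprocal 3 0) (reciprocal 2 1) r (≤-trans (antitoneˡℚ 2 0) (lossʳℚ 2 0))

    gapPQ : 0ℚ ≤ Up - Uq + (r - L) * (Up * Uq)
    gapPQ = reciprocal-gap (reciprocal 2 0) (reciprocal 1 1) (r - L) p≤q+[r-L]
      where
      regroup : ∀ C P Q R → Q + R - C ≡ Q + (R - (C - P)) - P
      regroup = solve-∀ ℚ-ring
      p≤q+[r-L] : p ≤ q + (r - L)
      p≤q+[r-L] = 0≤q-p⇒p≤q (subst (0ℚ ≤_) (regroup c₁ p q r) (0≤q-p (lossʳℚ 1 0)))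

    gapHM : 0ℚ ≤ Uh - Um + L * (Uh * Um)
    gapHM = reciprocal-gap (reciprocal 1 2) (reciprocal 2 1) L (≤-trans (antitoneʳℚ 1 1) q≤m+L)
      where
      regroup : ∀ C P Q M → C + M - (P + Q) ≡ M + (C - P) - Q
      regroup = solve-∀ ℚ-ring
      q≤m+L : q ≤ m + L
      q≤m+L = 0≤q-p⇒p≤q (subst (0ℚ ≤_) (regroup c₁ p q m) (0≤q-p (supermodularℚ 1 0)))

    gapSQ : 0ℚ ≤ Us - Uq + r * (Us * Uq)
    gapSQ = reciprocal-gap (reciprocal 0 2) (reciprocal 1 1) r (≤-trans (antitoneʳℚ 0 1) (lossˡℚ 0 1))

    gapHY : 0ℚ ≤ + 2 / 1 * (Up * Uz) - Uh * Uy
    gapHY = 0≤q-p (subst (_≤ + 2 / 1 * (Up * Uz)) (*-identityˡ (Uh * Uy))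
      (cross-invert (*-reciprocal (reciprocal 2 0) (reciprocal 3 1)) (*-reciprocal (reciprocal 1 2) (reciprocal 2 2))
        1ℚ (+ 2 / 1) pz≤2hy))
      where
      pz≤upper² : p * z ≤ (+ 33 / 2 * r) * (+ 33 / 2 * r)
      pz≤upper² = *-mono-≤-nonNeg (0≤x 2 0) (upperℚ 2 0) (0≤x 3 1) (upperℚ 3 1)
      lower²≤hy : ((+ 33 / 2 - fromℕ 3) * r) * ((+ 33 / 2 - fromℕ 4) * r) ≤ h * y
      lower²≤hy = *-mono-≤-nonNeg (0≤* (nonNegative⁻¹ _) 0≤r) (lowerℚ 1 2) (0≤* (nonNegative⁻¹ _) 0≤r) (lowerℚ 2 2)
      regroup : ∀ H Y P Z R →
        + 2 / 1 * (H * Y - ((+ 33 / 2 - fromℕ 3) * R) * ((+ 33 / 2 - fromℕ 4) * R))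
          + ((+ 33 / 2 * R) * (+ 33 / 2 * R) - P * Z) + + 261 / 4 * (R * R)
        ≡ + 2 / 1 * (H * Y) - 1ℚ * (P * Z)
      regroup = solve-∀ ℚ-ring
      pz≤2hy : 1ℚ * (p * z) ≤ + 2 / 1 * (h * y)
      pz≤2hy = 0≤q-p⇒p≤q (subst (0ℚ ≤_) (regroup h y p z r)
        (+-mono-≤ (+-mono-≤ (0≤* (nonNegative⁻¹ _) (0≤q-p lower²≤hy)) (0≤q-p pz≤upper²))
                  (0≤* (nonNegative⁻¹ (+ 261 / 4)) (0≤* 0≤r 0≤r))))

    r≼x : ∀ i j κ .{{_ : ℚ.NonNegative κ}} → κ * (+ 33 / 2 - fromℕ (i ℕ.+ j)) ≡ 1ℚ → r ≼⟨ κ ⟩ x i j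
    r≼x i j κ κβ≡1 = rescale (+ 33 / 2 - fromℕ (i ℕ.+ j)) κ κβ≡1 (lowerℚ i j)

    r≼p : r ≼⟨ + 2 / 29 ⟩ p
    r≼p = r≼x 2 0 (+ 2 / 29) refl
    r≼q : r ≼⟨ + 2 / 29 ⟩ q
    r≼q = r≼x 1 1 (+ 2 / 29) refl
    r≼s : r ≼⟨ + 2 / 29 ⟩ s
    r≼s = r≼x 0 2 (+ 2 / 29) refl
    r≼t : r ≼⟨ + 2 / 27 ⟩ t
    r≼t = r≼x 3 0 (+ 2 / 27) refl
    r≼m : r ≼⟨ + 2 / 27 ⟩ m
    r≼m = r≼x 2 1 (+ 2 / 27) refl
    r≼z : r ≼⟨ + 2 / 25 ⟩ z
    r≼z = r≼x 3 1 (+ 2 / 25) refl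

    p≤h+2r : p ≤ h + (r + r)
    p≤h+2r = ≤-trans p≤q+r (≤-trans (+-monoˡ-≤ r (lossʳℚ 1 1)) (≤-reflexive (+-assoc h r r)))

    p≤y+2r : p ≤ y + (r + r)
    p≤y+2r = ≤-trans (lossʳℚ 2 0) (≤-trans (+-monoˡ-≤ r (lossʳℚ 2 1)) (≤-reflexive (+-assoc y r r)))

    t≼z : t ≼⟨ + 27 / 25 ⟩ z
    t≼z = shrink (+ 27 / 25) refl (lossʳℚ 3 0) r≼t
    w≼z : w ≼⟨ + 27 / 25 ⟩ z
    w≼z = ≤-≼-trans (antitoneˡℚ 3 0) t≼z
    v≼o : v ≼⟨ + 25 / 23 ⟩ o
    v≼o = ≤-≼-trans (antitoneˡℚ 3 1) (shrink (+ 25 / 23) refl (lossʳℚ 3 1) r≼z)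
    p≼q : p ≼⟨ + 29 / 27 ⟩ q
    p≼q = shrink (+ 29 / 27) refl p≤q+r r≼p
    t≼m : t ≼⟨ + 29 / 27 ⟩ m
    t≼m = ≤-≼-trans (antitoneˡℚ 2 0) (shrink (+ 29 / 27) refl (lossʳℚ 2 0) r≼p)
    t≼h : t ≼⟨ + 29 / 25 ⟩ h
    t≼h = ≤-≼-trans (antitoneˡℚ 2 0) (shrink (+ 29 / 25) refl p≤h+2r (≼-+ r≼p r≼p))
    w≼y : w ≼⟨ + 29 / 25 ⟩ y
    w≼y = ≤-≼-trans (≤-trans (antitoneˡℚ 3 0) (antitoneˡℚ 2 0)) (shrink (+ 29 / 25) refl p≤y+2r (≼-+ r≼p r≼p))

    invert : ∀ {a b ua ub κ} → Reciprocal a ua → Reciprocal b ub → r * a ≼⟨ κ ⟩ b → 0ℚ ≤ κ * ua - r * ub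
    invert {κ = κ} ra rb (scaled ra≤κb) = 0≤q-p (cross-invert ra rb r κ ra≤κb)

    0≤w*v : 0ℚ ≤ w * v
    0≤w*v = 0≤* (0≤x 4 0) (0≤x 4 1)

    ratio-mzo : 0ℚ ≤ + 2 / 23 * (Uw * Uv) - r * (Um * (Uz * Uo))
    ratio-mzo = invert (*-reciprocal (reciprocal 4 0) (reciprocal 4 1))
                (*-reciprocal (reciprocal 2 1) (*-reciprocal (reciprocal 3 1) (reciprocal 3 2)))
                (≼-* 0≤r r≼m 0≤w*v (≼-* (0≤x 4 0) w≼z (0≤x 4 1) v≼o))

    ratio-mz : 0ℚ ≤ + 2 / 25 * Uw - r * (Um * Uz)
    ratio-mz = invert (reciprocal 4 0) (*-reciprocal (reciprocal 2 1) (reciprocal 3 1)) (≼-* 0≤r r≼m (0≤x 4 0) w≼z)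

    ratio-qmzo : 0ℚ ≤ + 2 / 23 * (Ut * (Uw * Uv)) - r * (Uq * (Um * (Uz * Uo)))
    ratio-qmzo = invert (*-reciprocal (reciprocal 3 0) (*-reciprocal (reciprocal 4 0) (reciprocal 4 1)))
                (*-reciprocal (reciprocal 1 1) (*-reciprocal (reciprocal 2 1) (*-reciprocal (reciprocal 3 1) (reciprocal 3 2))))
                (≼-* 0≤r r≼q (0≤* (0≤x 3 0) 0≤w*v) (≼-* (0≤x 3 0) t≼m 0≤w*v (≼-* (0≤x 4 0) w≼z (0≤x 4 1) v≼o)))

    ratio-qmz : 0ℚ ≤ + 2 / 25 * (Ut * Uw) - r * (Uq * (Um * Uz))
    ratio-qmz = invert (*-reciprocal (reciprocal 3 0) (reciprocal 4 0))
                (*-reciprocal (reciprocal 1 1) (*-reciprocal (reciprocal 2 1) (reciprocal 3 1)))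
                (≼-* 0≤r r≼q (0≤* (0≤x 3 0) (0≤x 4 0)) (≼-* (0≤x 3 0) t≼m (0≤x 4 0) w≼z))

    ratio-sqhyo : 0ℚ ≤ + 1682 / 15525 * (Up * (Ut * (Uw * Uv))) - r * (Us * (Uq * (Uh * (Uy * Uo))))
    ratio-sqhyo = invert (*-reciprocal (reciprocal 2 0) (*-reciprocal (reciprocal 3 0) (*-reciprocal (reciprocal 4 0) (reciprocal 4 1))))
                (*-reciprocal (reciprocal 0 2) (*-reciprocal (reciprocal 1 1)
                  (*-reciprocal (reciprocal 1 2) (*-reciprocal (reciprocal 2 2) (reciprocal 3 2)))))
                (≼-* 0≤r r≼s (0≤* (0≤x 2 0) (0≤* (0≤x 3 0) 0≤w*v))
                  (≼-* (0≤x 2 0) p≼q (0≤* (0≤x 3 0) 0≤w*v) (≼-* (0≤x 3 0) t≼h 0≤w*v (≼-* (0≤x 4 0) w≼y (0≤x 4 1) v≼o))))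

    ratio-qmyo : 0ℚ ≤ + 58 / 621 * (Ut * (Uw * Uv)) - r * (Uq * (Um * (Uy * Uo)))
    ratio-qmyo = invert (*-reciprocal (reciprocal 3 0) (*-reciprocal (reciprocal 4 0) (reciprocal 4 1)))
                (*-reciprocal (reciprocal 1 1) (*-reciprocal (reciprocal 2 1) (*-reciprocal (reciprocal 2 2) (reciprocal 3 2))))
                (≼-* 0≤r r≼q (0≤* (0≤x 3 0) 0≤w*v) (≼-* (0≤x 3 0) t≼m 0≤w*v (≼-* (0≤x 4 0) w≼y (0≤x 4 1) v≼o)))

    0≤κ* : ∀ {κ a} .{{_ : ℚ.NonNegative κ}} → 0ℚ ≤ a → 0ℚ ≤ κ * a
    0≤κ* {κ} = 0≤* (nonNegative⁻¹ κ)

  pathSum-nonneg : 0ℚ ≤ pathSum c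
  pathSum-nonneg = subst (0ℚ ≤_) (sym (pathSum-certificate r L Up Uq Us Ut Um Uh Uw Uz Uy Uv Uo))
    (+-mono-≤ (+-mono-≤ (+-mono-≤ (+-mono-≤ (+-mono-≤ (+-mono-≤ (+-mono-≤
     (+-mono-≤ (+-mono-≤ (+-mono-≤ (+-mono-≤ (+-mono-≤ (+-mono-≤ (+-mono-≤
     (0≤κ* (0≤* (0≤* (0≤* (0≤u 2 0) (0≤u 3 1)) (+-mono-≤ (0≤u 3 2) (0≤u 4 1))) gapTM))
     (0≤κ* (0≤* (0≤* (0≤* (0≤u 2 1) (0≤u 3 1)) (+-mono-≤ (0≤u 3 2) (0≤u 4 1))) gapPQ)))
     (0≤κ* (0≤* (0≤* (0≤* (0≤u 1 1) (0≤u 2 2)) (0≤u 3 2)) gapHM)))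
     (0≤κ* (0≤* (0≤* (0≤* (0≤u 1 2) (0≤u 2 2)) (0≤u 3 2)) gapSQ)))
     (0≤κ* (0≤* (0≤* (0≤* (0≤u 2 1) (0≤u 2 2)) (0≤u 3 2)) gapPQ)))
     (0≤κ* (0≤* (0≤* (0≤* (0≤* 0≤L (0≤u 2 1)) (0≤u 1 1)) (0≤u 3 2)) gapHY)))
     (0≤κ* (0≤* (0≤* (0≤* (0≤* (0≤* 0≤L (0≤u 2 1)) (0≤u 2 0)) (0≤u 1 1)) (0≤u 3 1)) (0≤u 4 1))))
     (0≤κ* (0≤* (0≤* (0≤* (0≤* (0≤* 0≤L (0≤u 2 1)) (0≤u 2 0)) (0≤u 1 1)) (0≤u 2 2)) (0≤u 3 2))))
     (0≤κ* (0≤* (0≤* (0≤u 2 0) (0≤u 3 0)) ratio-mzo)))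
     (0≤κ* (0≤* (0≤* (0≤* (0≤u 2 0) (0≤u 3 0)) (0≤u 4 1)) ratio-mz)))
     (0≤κ* (0≤* (0≤u 2 0) ratio-qmzo)))
     (0≤κ* (0≤* (0≤* (0≤u 2 0) (0≤u 4 1)) ratio-qmz)))
     (0≤κ* ratio-sqhyo))
     (0≤κ* (0≤* (0≤u 2 0) ratio-qmyo)))
     (0≤κ* (0≤* (0≤* (0≤* (0≤u 2 0) (0≤u 3 0)) (0≤u 4 0)) (0≤u 4 1))))

module _ {n : ℕ} (G : Graph n) where

  isCommonNbr : List (Fin n) → Fin n → Bool
  isCommonNbr S w = all (λ v → adj G v w) S

  private
    indicator : Bool → ℕ
    indicator b = if b then 1 else 0

    count : (Fin n → Bool) → ℕ
    count P = sum (map (λ w → indicator (P w)) (allFin n))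

    count-pointwise : ∀ {P Q R S} → (∀ w → indicator (P w) ℕ.+ indicator (Q w) ℕ.≤ indicator (R w) ℕ.+ indicator (S w)) →
                      count P ℕ.+ count Q ℕ.≤ count R ℕ.+ count S
    count-pointwise {P} {Q} {R} {S} pw = subst₂ ℕ._≤_ (sum-map-+ (allFin n) _ _) (sum-map-+ (allFin n) _ _)
      (sum-map-mono (allFin n) pw)

    count-true : count (λ _ → true) ≡ n
    count-true = trans (ones (allFin n)) (List.length-tabulate id)
      where
      ones : ∀ (ws : List (Fin n)) → sum (map (λ _ → 1) ws) ≡ length ws
      ones []       = refl
      ones (w ∷ ws) = cong suc (ones ws)

    count-cong : ∀ {P Q} → (∀ w → P w ≡ Q w) → count P ≡ count Q
    count-cong P≗Q = cong sum (List.map-cong (cong indicator ∘ P≗Q) (allFin n))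

  commonNbrCount-[] : commonNbrCount G [] ≡ n
  commonNbrCount-[] = count-true

  commonNbrCount-↭ : ∀ {S S′} → S ↭ S′ → commonNbrCount G S ≡ commonNbrCount G S′
  commonNbrCount-↭ S↭S′ = count-cong (λ w → all-↭ (λ v → adj G v w) S↭S′)

  commonNbrCount-antitone : ∀ S T → commonNbrCount G (S ++ T) ℕ.≤ commonNbrCount G S
  commonNbrCount-antitone S T = sum-map-mono (allFin n) pointwise
    where
    pointwise : ∀ w → indicator (isCommonNbr (S ++ T) w) ℕ.≤ indicator (isCommonNbr S w)
    pointwise w rewrite all-++ (λ v → adj G v w) S T with isCommonNbr S w | isCommonNbr T w
    ... | true  | true  = ℕ.≤-refl
    ... | true  | false = z≤n
    ... | false | _     = ℕ.≤-refl

  commonNbrCount-loss : ∀ S v → commonNbrCount G S ℕ.+ degree G v ℕ.≤ commonNbrCount G (S ++ [ v ]) ℕ.+ n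
  commonNbrCount-loss S v = subst (commonNbrCount G S ℕ.+ degree G v ℕ.≤_) (cong (commonNbrCount G (S ++ [ v ]) ℕ.+_) count-true)
    (count-pointwise {isCommonNbr S} {adj G v} {isCommonNbr (S ++ [ v ])} {λ _ → true} pointwise)
    where
    pointwise : ∀ w → indicator (isCommonNbr S w) ℕ.+ indicator (adj G v w) ℕ.≤ indicator (isCommonNbr (S ++ [ v ]) w) ℕ.+ 1
    pointwise w rewrite all-++ (λ u → adj G u w) S [ v ] with isCommonNbr S w | adj G v w
    ... | true  | true  = ℕ.≤-refl
    ... | true  | false = s≤s z≤n
    ... | false | true  = s≤s z≤n
    ... | false | false = z≤n

  commonNbrCount-supermodular : ∀ S T U →
    commonNbrCount G (S ++ T) ℕ.+ commonNbrCount G (S ++ U) ℕ.≤ commonNbrCount G S ℕ.+ commonNbrCount G (S ++ T ++ U)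
  commonNbrCount-supermodular S T U =
    count-pointwise {isCommonNbr (S ++ T)} {isCommonNbr (S ++ U)} {isCommonNbr S} {isCommonNbr (S ++ T ++ U)} pointwise
    where
    pointwise : ∀ w → indicator (isCommonNbr (S ++ T) w) ℕ.+ indicator (isCommonNbr (S ++ U) w)
                    ℕ.≤ indicator (isCommonNbr S w) ℕ.+ indicator (isCommonNbr (S ++ T ++ U) w)
    pointwise w rewrite all-++ (λ v → adj G v w) S T | all-++ (λ v → adj G v w) S U
                      | all-++ (λ v → adj G v w) S (T ++ U) | all-++ (λ v → adj G v w) T U
                      with isCommonNbr S w | isCommonNbr T w | isCommonNbr U w
    ... | false | _     | _     = ℕ.≤-refl
    ... | true  | true  | true  = ℕ.≤-refl
    ... | true  | true  | false = ℕ.≤-refl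
    ... | true  | false | true  = ℕ.≤-refl
    ... | true  | false | false = z≤n

  commonNbrCount-loss₃₃ : (∀ u → 31 ℕ.* n ℕ.≤ 33 ℕ.* degree G u) →
    ∀ S Z → 33 ℕ.* commonNbrCount G S ℕ.≤ 33 ℕ.* commonNbrCount G (S ++ take 1 Z) ℕ.+ 2 ℕ.* n
  commonNbrCount-loss₃₃ minDegree S []      = subst (λ T → 33 ℕ.* commonNbrCount G S ℕ.≤ 33 ℕ.* commonNbrCount G T ℕ.+ 2 ℕ.* n)
    (sym (List.++-identityʳ S)) (ℕ.m≤m+n _ _)
  commonNbrCount-loss₃₃ minDegree S (v ∷ _) = ℕ.+-cancelʳ-≤ (31 ℕ.* n) _ _ (begin
    33 ℕ.* cS ℕ.+ 31 ℕ.* n                ≤⟨ ℕ.+-monoʳ-≤ (33 ℕ.* cS) (minDegree v) ⟩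
    33 ℕ.* cS ℕ.+ 33 ℕ.* degree G v       ≡⟨ ℕ.*-distribˡ-+ 33 cS (degree G v) ⟨
    33 ℕ.* (cS ℕ.+ degree G v)            ≤⟨ ℕ.*-monoʳ-≤ 33 (commonNbrCount-loss S v) ⟩
    33 ℕ.* (cSv ℕ.+ n)                    ≡⟨ regroup cSv n ⟩
    33 ℕ.* cSv ℕ.+ 2 ℕ.* n ℕ.+ 31 ℕ.* n   ∎)
    where
    open ℕ.≤-Reasoning
    cS cSv : ℕ
    cS  = commonNbrCount G S
    cSv = commonNbrCount G (S ++ [ v ])
    regroup : ∀ a b → 33 ℕ.* (a ℕ.+ b) ≡ 33 ℕ.* a ℕ.+ 2 ℕ.* b ℕ.+ 31 ℕ.* b
    regroup = ℕ-Solver.solve-∀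

module _ {n : ℕ} (G : Graph n) (X Y : List (Fin n)) where

  neighbourhoodGrid : ℕ → ℕ → ℕ
  neighbourhoodGrid i j = commonNbrCount G (take i X ++ take j Y)

  private
    S : ℕ → ℕ → List (Fin n)
    S i j = take i X ++ take j Y

    nextX nextY : ℕ → List (Fin n)
    nextX i = take 1 (drop i X)
    nextY j = take 1 (drop j Y)

    gridˡ : ∀ i j → neighbourhoodGrid (suc i) j ≡ commonNbrCount G (S i j ++ nextX i)
    gridˡ i j = commonNbrCount-↭ G (take-suc-++-↭ i j X Y)

    gridʳ : ∀ i j → neighbourhoodGrid i (suc j) ≡ commonNbrCount G (S i j ++ nextY j)
    gridʳ i j = cong (commonNbrCount G) (++-take-suc i j X Y)

    gridˡʳ : ∀ i j → neighbourhoodGrid (suc i) (suc j) ≡ commonNbrCount G (S i j ++ nextX i ++ nextY j)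
    gridˡʳ i j = commonNbrCount-↭ G (begin
      take (suc i) X ++ take (suc j) Y                  ≡⟨ cong₂ _++_ (take-suc-drop i X) (take-suc-drop j Y) ⟩
      (take i X ++ nextX i) ++ (take j Y ++ nextY j)    ≡⟨ List.++-assoc (take i X) (nextX i) (take j Y ++ nextY j) ⟩
      take i X ++ (nextX i ++ take j Y ++ nextY j)      ↭⟨ ↭.++⁺ˡ (take i X) (↭.shifts (nextX i) (take j Y)) ⟩
      take i X ++ (take j Y ++ nextX i ++ nextY j)      ≡⟨ List.++-assoc (take i X) (take j Y) (nextX i ++ nextY j) ⟨
      S i j ++ nextX i ++ nextY j                       ∎)
      where open PermutationReasoning

  neighbourhoodGrid-countGrid : (∀ u → 31 ℕ.* n ℕ.≤ 33 ℕ.* degree G u) → CountGrid n neighbourhoodGrid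
  neighbourhoodGrid-countGrid minDegree = record
    { origin       = commonNbrCount-[] G
    ; antitoneˡ    = antitoneˡ
    ; antitoneʳ    = antitoneʳ
    ; lossˡ        = lossˡ
    ; lossʳ        = lossʳ
    ; supermodular = supermodular
    }
    where
    c : ℕ → ℕ → ℕ
    c = neighbourhoodGrid
    antitoneˡ : ∀ i j → c (suc i) j ℕ.≤ c i j
    antitoneˡ i j rewrite gridˡ i j = commonNbrCount-antitone G (S i j) (nextX i)
    antitoneʳ : ∀ i j → c i (suc j) ℕ.≤ c i j
    antitoneʳ i j rewrite gridʳ i j = commonNbrCount-antitone G (S i j) (nextY j)
    lossˡ : ∀ i j → 33 ℕ.* c i j ℕ.≤ 33 ℕ.* c (suc i) j ℕ.+ 2 ℕ.* n
    lossˡ i j rewrite gridˡ i j = commonNbrCount-loss₃₃ G minDegree (S i j) (drop i X)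
    lossʳ : ∀ i j → 33 ℕ.* c i j ℕ.≤ 33 ℕ.* c i (suc j) ℕ.+ 2 ℕ.* n
    lossʳ i j rewrite gridʳ i j = commonNbrCount-loss₃₃ G minDegree (S i j) (drop j Y)
    supermodular : ∀ i j → c (suc i) j ℕ.+ c i (suc j) ℕ.≤ c i j ℕ.+ c (suc i) (suc j)
    supermodular i j rewrite gridˡ i j | gridʳ i j | gridˡʳ i j =
      commonNbrCount-supermodular G (S i j) (nextX i) (nextY j)

-- `Wt` with its accumulator exposed (the one in `Defs` is private); the two unfold to the
-- same product on lists of known length.
module _ {n : ℕ} (G : Graph n) where

  weightFrom : List (Fin n) → List (Fin n) → ℚ
  weightFrom acc []       = 1ℚ
  weightFrom acc (x ∷ xs) = invℕ (commonNbrCount G (acc ++ [ x ])) * weightFrom (acc ++ [ x ]) xs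

  weight : List (Fin n) → ℚ
  weight []       = 1ℚ
  weight (v ∷ vs) = weightFrom [ v ] vs

  weight-nonNeg : ∀ vs → 0ℚ ≤ weight vs
  weight-nonNeg []       = nonNegative⁻¹ 1ℚ
  weight-nonNeg (v ∷ vs) = go [ v ] vs
    where
    go : ∀ acc xs → 0ℚ ≤ weightFrom acc xs
    go acc []       = nonNegative⁻¹ 1ℚ
    go acc (x ∷ xs) = 0≤* (invℕ-nonNeg (commonNbrCount G (acc ++ [ x ]))) (go (acc ++ [ x ]) xs)

module _ {n : ℕ} (G : Graph n) (X Y : List (Fin n)) where

  weightFrom-interleave : ∀ ρ k i j acc {Xr Yr} → drop i X ≡ Xr → drop j Y ≡ Yr → Fits ρ Xr Yr →
    acc ↭ take i X ++ take j Y →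
    weightFrom G acc (take k (interleave ρ Xr Yr)) ≡ weightAlong (neighbourhoodGrid G X Y) i j (take k ρ)
  weightFrom-interleave ρ           zero    i j acc                  _     _     _   _    = refl
  weightFrom-interleave []          (suc k) i j acc                  _     _     _   _    = refl
  weightFrom-interleave (true  ∷ ρ) (suc k) i j acc {[]}             _     _     ()  _
  weightFrom-interleave (true  ∷ ρ) (suc k) i j acc {x ∷ Xr}         dropX dropY fit acc↭ =
    cong₂ _*_ (cong invℕ (commonNbrCount-↭ G acc′↭))
              (weightFrom-interleave ρ k (suc i) j (acc ++ [ x ]) (drop-suc i X dropX) dropY fit acc′↭)
    where
    acc′↭ : acc ++ [ x ] ↭ take (suc i) X ++ take j Y
    acc′↭ = ↭-trans (↭.++⁺ʳ [ x ] acc↭)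
      (↭-sym (subst (λ T → take (suc i) X ++ take j Y ↭ (take i X ++ take j Y) ++ T) (cong (take 1) dropX) (take-suc-++-↭ i j X Y)))
  weightFrom-interleave (false ∷ ρ) (suc k) i j acc {Xr} {[]}      _     _     ()  _
  weightFrom-interleave (false ∷ ρ) (suc k) i j acc {Xr} {y ∷ Yr}  dropX dropY fit acc↭ =
    cong₂ _*_ (cong invℕ (commonNbrCount-↭ G acc′↭))
              (weightFrom-interleave ρ k i (suc j) (acc ++ [ y ]) dropX (drop-suc j Y dropY) fit acc′↭)
    where
    acc′↭ : acc ++ [ y ] ↭ take i X ++ take (suc j) Y
    acc′↭ = ↭-trans (↭.++⁺ʳ [ y ] acc↭)
      (↭-reflexive (sym (trans (++-take-suc i j X Y) (cong ((take i X ++ take j Y) ++_) (cong (take 1) dropY)))))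

weight-interleave : ∀ {n} (G : Graph n) π (X Y : List (Fin n)) → Fits π X Y →
  weight G (take 5 (interleave π X Y)) ≡ pathWeight (neighbourhoodGrid G X Y) π
weight-interleave G []          []      []      _   = refl
weight-interleave G (true  ∷ ρ) (x ∷ X) Y       fit = weightFrom-interleave G (x ∷ X) Y ρ 4 1 0 [ x ] refl refl fit ↭-refl
weight-interleave G (false ∷ ρ) X       (y ∷ Y) fit = weightFrom-interleave G X (y ∷ Y) ρ 4 0 1 [ y ] refl refl fit ↭-refl

==-refl : ∀ {n} (x : Fin n) → (x == x) ≡ true
==-refl x = dec-true (x Fin.≟ x) refl

==-false : ∀ {n} {x y : Fin n} → x ≢ y → (x == y) ≡ false
==-false {x = x} {y} x≢y = dec-false (x Fin.≟ y) x≢y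

==⇒≡ : ∀ {n} {x y : Fin n} → (x == y) ≡ true → x ≡ y
==⇒≡ {x = x} {y} eq with x Fin.≟ y
... | yes x≡y = x≡y

∈ᵇ-∈ : ∀ {n} {x : Fin n} {xs} → x ∈ xs → (x ∈ᵇ xs) ≡ true
∈ᵇ-∈ {x = x} {x ∷ xs} (here refl) = cong (_∨ (x ∈ᵇ xs)) (==-refl x)
∈ᵇ-∈ {x = x} {y ∷ xs} (there p) = trans (cong ((x == y) ∨_) (∈ᵇ-∈ p)) (∨-zeroʳ (x == y))

∈ᵇ-∉ : ∀ {n} {x : Fin n} {xs} → All (x ≢_) xs → (x ∈ᵇ xs) ≡ false
∈ᵇ-∉ []             = refl
∈ᵇ-∉ (x≢y ∷ x∉xs) = cong₂ _∨_ (==-false x≢y) (∈ᵇ-∉ x∉xs)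

module _ {n : ℕ} (G : Graph n) where

  Adjacent : Fin n → Fin n → Set
  Adjacent u v = adj G u v ≡ true

  adjacent-sym : ∀ {u v} → Adjacent u v → Adjacent v u
  adjacent-sym {u} {v} u~v = trans (Graph.sym G v u) u~v

  adjacent⇒≢ : ∀ {u v} → Adjacent u v → u ≢ v
  adjacent⇒≢ {u} u~u refl with trans (sym u~u) (irrefl G u)
  ... | ()

  IsClique : List (Fin n) → Set
  IsClique = AllPairs Adjacent

  adjacent? : ∀ u v → Dec (Adjacent u v)
  adjacent? u v = adj G u v Bool.≟ true

  isCliqueᵇ : List (Fin n) → Bool
  isCliqueᵇ vs = does (allPairs? adjacent? vs)

  isCliqueᵇ⇒IsClique : ∀ {vs} → isCliqueᵇ vs ≡ true → IsClique vs
  isCliqueᵇ⇒IsClique {vs} eq with allPairs? adjacent? vs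
  ... | yes clique = clique

  isClique-↭ : ∀ {vs ws} → vs ↭ ws → IsClique vs → IsClique ws
  isClique-↭ vs↭ws = ↭ₛ.AllPairs-resp-↭ (setoid (Fin n)) adjacent-sym (resp₂ Adjacent) (↭⇒↭ₛ vs↭ws)

  isCliqueᵇ-↭ : ∀ {vs ws} → vs ↭ ws → isCliqueᵇ vs ≡ isCliqueᵇ ws
  isCliqueᵇ-↭ {vs} {ws} vs↭ws =
    does-⇔ (mk⇔ (isClique-↭ vs↭ws) (isClique-↭ (↭-sym vs↭ws))) (allPairs? adjacent? vs) (allPairs? adjacent? ws)

  isClique⇒unique : ∀ {vs} → IsClique vs → Unique vs
  isClique⇒unique = AllPairs.map adjacent⇒≢

  isOrdClique⇔isClique : ∀ {l} (K : Fin l → Fin n) → T (isOrdClique G K) ⇔ IsClique (VF.toList K)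
  isOrdClique⇔isClique {l} K = mk⇔ to from
    where
    cell : Fin l → Fin l → Bool
    cell i j = does (i Fin.≟ j) ∨ (adj G (K i) (K j) ∧ not (K i == K j))
    row : Fin l → Bool
    row i = all (cell i) (allFin l)
    cell⇒ : ∀ i j → T (cell i j) → i ≢ j → Adjacent (K i) (K j)
    cell⇒ i j cellᵢⱼ i≢j with i Fin.≟ j
    ... | yes i≡j = ⊥-elim (i≢j i≡j)
    ... | no  _   = Equivalence.to T-≡ (proj₁ (Equivalence.to T-∧ cellᵢⱼ))
    ⇒cell : ∀ i j → (∀ {i j} → i ≢ j → Adjacent (K i) (K j)) → T (cell i j)
    ⇒cell i j pairwise with i Fin.≟ j
    ... | yes _   = _
    ... | no  i≢j rewrite pairwise i≢j | ==-false (adjacent⇒≢ (pairwise i≢j)) = _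
    to : T (isOrdClique G K) → IsClique (VF.toList K)
    to ordClique = AllPairs.tabulate⁺ (λ {i} {j} → cell⇒ i j (cellᵢⱼ i j))
      where
      cellᵢⱼ : ∀ i j → T (cell i j)
      cellᵢⱼ i j = All.lookup (All.all⁺ (cell i) (allFin l) (All.lookup (All.all⁺ row (allFin l) ordClique) (∈-allFin i)))
                              (∈-allFin j)
    from : IsClique (VF.toList K) → T (isOrdClique G K)
    from clique = All.all⁻ row {xs = allFin l} (All.tabulate (λ {i} _ →
      All.all⁻ (cell i) {xs = allFin l} (All.tabulate (λ {j} _ → ⇒cell i j (AllPairs-tabulate⁻ adjacent-sym clique)))))

  isOrdClique≡isCliqueᵇ : ∀ {l} (K : Fin l → Fin n) → isOrdClique G K ≡ isCliqueᵇ (VF.toList K)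
  isOrdClique≡isCliqueᵇ K =
    does-⇔ (isOrdClique⇔isClique K) (T? (isOrdClique G K)) (allPairs? adjacent? (VF.toList K))

isSubseq-∉ : ∀ {n} {x : Fin n} xs {ys} → All (x ≢_) ys → isSubseq (x ∷ xs) ys ≡ false
isSubseq-∉ xs []             = refl
isSubseq-∉ xs (x≢y ∷ x∉ys) = cong₂ _∨_ (cong (_∧ _) (==-false x≢y)) (isSubseq-∉ xs x∉ys)

embeddings-unique : ∀ {n} (xs ys : List (Fin n)) → Unique ys → embeddings xs ys ≡ (if isSubseq xs ys then 1ℚ else 0ℚ)
embeddings-unique []       ys       _              = refl
embeddings-unique (x ∷ xs) []       _              = refl
embeddings-unique (x ∷ xs) (y ∷ ys) (y∉ys ∷ uniq) with x == y in x==y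
... | true  = begin
  1ℚ * embeddings xs ys + embeddings (x ∷ xs) ys
    ≡⟨ cong₂ _+_ (*-identityˡ (embeddings xs ys)) (trans (embeddings-unique (x ∷ xs) ys uniq) (cong (λ b → if b then 1ℚ else 0ℚ) x∉ys)) ⟩
  embeddings xs ys + 0ℚ
    ≡⟨ trans (+-identityʳ (embeddings xs ys)) (embeddings-unique xs ys uniq) ⟩
  (if isSubseq xs ys then 1ℚ else 0ℚ)
    ≡⟨ cong (λ b → if b then 1ℚ else 0ℚ) (trans (cong (isSubseq xs ys ∨_) x∉ys) (∨-identityʳ (isSubseq xs ys))) ⟨
  (if isSubseq xs ys ∨ isSubseq (x ∷ xs) ys then 1ℚ else 0ℚ) ∎
  where
  open ≡-Reasoning
  x∉ys : isSubseq (x ∷ xs) ys ≡ false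
  x∉ys = isSubseq-∉ xs (subst (λ z → All (z ≢_) ys) (sym (==⇒≡ x==y)) y∉ys)
... | false = trans (cong (_+ embeddings (x ∷ xs) ys) (*-zeroˡ (embeddings xs ys)))
                    (trans (+-identityˡ (embeddings (x ∷ xs) ys)) (embeddings-unique (x ∷ xs) ys uniq))

ψ-⊆ : ∀ {n} (Kv : List (Fin n)) a b Tv → all (_∈ᵇ Kv) Tv ≡ true → ψ Kv a b Tv ≡ pathψ ((a ∈ᵇ Tv) ∷ (b ∈ᵇ Tv) ∷ [])
ψ-⊆ Kv a b Tv Tv⊆Kv with all (_∈ᵇ Kv) Tv | a ∈ᵇ Tv | b ∈ᵇ Tv
... | true | true  | true  = refl
... | true | true  | false = refl
... | true | false | true  = refl
... | true | false | false = refl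

pathψ-head : ∀ b₀ b₁ ρ → pathψ (b₀ ∷ b₁ ∷ ρ) ≡ pathψ (b₀ ∷ b₁ ∷ [])
pathψ-head true  true  ρ = refl
pathψ-head true  false ρ = refl
pathψ-head false true  ρ = refl
pathψ-head false false ρ = refl

map-∈ᵇ-interleave : ∀ {n} (O : List (Fin n)) π {Xr Yr} → Fits π Xr Yr →
  All (λ x → (x ∈ᵇ O) ≡ true) Xr → All (λ y → (y ∈ᵇ O) ≡ false) Yr → map (_∈ᵇ O) (interleave π Xr Yr) ≡ π
map-∈ᵇ-interleave O []          {[]}     {[]}     _   []          []          = refl
map-∈ᵇ-interleave O (true  ∷ π) {x ∷ Xr} {Yr}     fit (x∈O ∷ Xr∈O) Yr∉O        = cong₂ _∷_ x∈O (map-∈ᵇ-interleave O π fit Xr∈O Yr∉O)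
map-∈ᵇ-interleave O (false ∷ π) {Xr}     {y ∷ Yr} fit Xr∈O        (y∉O ∷ Yr∉O) = cong₂ _∷_ y∉O (map-∈ᵇ-interleave O π fit Xr∈O Yr∉O)

module _ {n : ℕ} (G : Graph n) (O : List (Fin n)) where

  contribution : List (Fin n) → ℚ
  contribution (u ∷ v ∷ l) = if isCliqueᵇ G (u ∷ v ∷ l) then weight G (take 5 (u ∷ v ∷ l)) * ψ (u ∷ v ∷ l) u v O else 0ℚ
  contribution _           = 0ℚ

  contribution-non-clique : ∀ l → isCliqueᵇ G l ≡ false → contribution l ≡ 0ℚ
  contribution-non-clique []          _ = refl
  contribution-non-clique (u ∷ [])    _ = refl
  contribution-non-clique (u ∷ v ∷ l) non-clique rewrite non-clique = refl

  contribution-∷∷ : ∀ u v l → isCliqueᵇ G (u ∷ v ∷ l) ≡ true →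
    contribution (u ∷ v ∷ l) ≡ weight G (take 5 (u ∷ v ∷ l)) * ψ (u ∷ v ∷ l) u v O
  contribution-∷∷ u v l clique rewrite clique = refl

  contribution-clique : ∀ l → 2 ℕ.≤ length l → isCliqueᵇ G l ≡ true → all (_∈ᵇ l) O ≡ true →
    contribution l ≡ weight G (take 5 l) * pathψ (map (_∈ᵇ O) l)
  contribution-clique (u ∷ [])    (s≤s ())
  contribution-clique (u ∷ v ∷ l) _ clique O⊆l = trans (contribution-∷∷ u v l clique)
    (cong (weight G (take 5 (u ∷ v ∷ l)) *_) (trans (ψ-⊆ (u ∷ v ∷ l) u v O O⊆l) (sym (pathψ-head (u ∈ᵇ O) (v ∈ᵇ O) _))))

interleavings-nonneg : ∀ {n} (G : Graph n) → (∀ u → 31 ℕ.* n ℕ.≤ 33 ℕ.* degree G u) → (O : Fin 4 → Fin n) (a b : Fin n) →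
  0ℚ ≤ ∑[ π ∈ latticePaths 4 2 ] contribution G (VF.toList O) (interleave π (VF.toList O) (a ∷ b ∷ []))
interleavings-nonneg {suc n} G minDegree O a b = by-clique (isCliqueᵇ G (X ++ Y)) refl
  where
  X Y : List (Fin (suc n))
  X = VF.toList O
  Y = a ∷ b ∷ []

  term : List Bool → ℚ
  term π = contribution G X (interleave π X Y)

  by-clique : ∀ c → isCliqueᵇ G (X ++ Y) ≡ c → 0ℚ ≤ ∑ (latticePaths 4 2) term
  by-clique false non-clique =
    ≤-reflexive (sym (trans (∑-cong-All {f = term} (All.map (λ {π} → vanish {π}) (latticePaths-fit X Y))) (∑-zero (latticePaths 4 2))))
    where
    vanish : ∀ {π} → Fits π X Y → contribution G X (interleave π X Y) ≡ 0ℚ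
    vanish {π} fit = contribution-non-clique G X (interleave π X Y) (trans (isCliqueᵇ-↭ G (interleave-↭ π X Y fit)) non-clique)
  by-clique true clique =
    subst (0ℚ ≤_) (sym (∑-cong-All {f = term} {g = λ π → pathWeight (neighbourhoodGrid G X Y) π * pathψ π}
                                   (All.map (λ {π} → evaluate {π}) (latticePaths-fit X Y))))
                  (pathSum-nonneg (neighbourhoodGrid-countGrid G X Y minDegree))
    where
    cross : All (λ x → All (Adjacent G x) Y) X
    cross = AllPairs-++-between {xs = X} {ys = Y} (isCliqueᵇ⇒IsClique G clique)
    X∈X : All (λ x → (x ∈ᵇ X) ≡ true) X
    X∈X = All.tabulate ∈ᵇ-∈
    Y∉X : All (λ y → (y ∈ᵇ X) ≡ false) Y
    Y∉X = All.tabulate (λ y∈Y → ∈ᵇ-∉ (All.map (λ x~Y y≡x → adjacent⇒≢ G (All.lookup x~Y y∈Y) (sym y≡x)) cross))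
    evaluate : ∀ {π} → Fits π X Y → contribution G X (interleave π X Y) ≡ pathWeight (neighbourhoodGrid G X Y) π * pathψ π
    evaluate {π} fit = trans
      (contribution-clique G X l (subst (2 ℕ.≤_) (sym (↭.↭-length l↭)) (s≤s (s≤s z≤n)))
        (trans (isCliqueᵇ-↭ G l↭) clique)
        (all-true {xs = X} (All.tabulate (λ x∈X → ∈ᵇ-∈ (↭.∈-resp-↭ (↭-sym l↭) (∈-++⁺ˡ {ys = Y} x∈X))))))
      (cong₂ _*_ (weight-interleave G π X Y fit) (cong pathψ (map-∈ᵇ-interleave X π fit X∈X Y∉X)))
      where
      l : List (Fin (suc n))
      l = interleave π X Y
      l↭ : l ↭ X ++ Y
      l↭ = interleave-↭ π X Y fit

module _ {n : ℕ} (G : Graph n) (O : Fin 4 → Fin n) where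

  private
    X : List (Fin n)
    X = VF.toList O

  summand : (Fin 6 → Fin n) → ℚ
  summand K = if inOK6 G O K then Wt G (take 5 (VF.toList K)) * ψ (VF.toList K) (K Fin.zero) (K (Fin.suc Fin.zero)) X else 0ℚ

  summand≡ : ∀ K → summand K ≡ embeddings X (VF.toList K) * contribution G X (VF.toList K)
  summand≡ K = trans (cong (λ c → if c ∧ isSubseq X l then Wψ else 0ℚ) (isOrdClique≡isCliqueᵇ G K))
                     (by-clique (isCliqueᵇ G l) refl)
    where
    l : List (Fin n)
    l = VF.toList K
    Wψ : ℚ
    Wψ = weight G (take 5 l) * ψ l (K Fin.zero) (K (Fin.suc Fin.zero)) X
    by-subseq : ∀ s → (if s then Wψ else 0ℚ) ≡ (if s then 1ℚ else 0ℚ) * Wψ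
    by-subseq true  = sym (*-identityˡ Wψ)
    by-subseq false = sym (*-zeroˡ Wψ)
    by-clique : ∀ c → isCliqueᵇ G l ≡ c → (if c ∧ isSubseq X l then Wψ else 0ℚ) ≡ embeddings X l * contribution G X l
    by-clique false non-clique =
      trans (sym (*-zeroʳ (embeddings X l))) (cong (embeddings X l *_) (sym (contribution-non-clique G X l non-clique)))
    by-clique true  clique     = trans (by-subseq (isSubseq X l)) (sym (cong₂ _*_
      (embeddings-unique X l (isClique⇒unique G (isCliqueᵇ⇒IsClique G clique)))
      (contribution-∷∷ G X (K Fin.zero) (K (Fin.suc Fin.zero)) (VF.toList (λ i → K (Fin.suc (Fin.suc i)))) clique)))

  W_G-nonneg : (∀ u → 31 ℕ.* n ℕ.≤ 33 ℕ.* degree G u) → 0ℚ ≤ W_G G O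
  W_G-nonneg minDegree = 0≤* (nonNegative⁻¹ (+ 1 / 2)) (subst (0ℚ ≤_) (sym ∑summand≡) pairs-nonneg)
    where
    pairSum : List (Fin n) → ℚ
    pairSum e = ∑[ π ∈ latticePaths 4 2 ] contribution G X (interleave π X e)
    ∑summand≡ : ∑ (allTuples 6) summand ≡ ∑ (words 2) pairSum
    ∑summand≡ = begin
      ∑ (allTuples 6) summand                                        ≡⟨ ∑-cong (allTuples 6) summand≡ ⟩
      ∑[ K ∈ allTuples 6 ] embeddings X (VF.toList K) * contribution G X (VF.toList K)
                                                                     ≡⟨ ∑-allTuples 6 (λ l → embeddings X l * contribution G X l) ⟩
      ∑[ l ∈ words 6 ] embeddings X l * contribution G X l           ≡⟨ ∑-embeddings X 6 2 refl (contribution G X) ⟩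
      ∑ (words 2) pairSum                                            ∎
      where open ≡-Reasoning
    pairs-nonneg : 0ℚ ≤ ∑ (words 2) pairSum
    pairs-nonneg = subst (0ℚ ≤_) (sym (∑-words-suc 1 pairSum))
      (∑-nonNeg (allFin n) (λ a → subst (0ℚ ≤_) (sym (∑-words-suc 0 (λ l → pairSum (a ∷ l))))
        (∑-nonNeg (allFin n) (λ b → +-mono-≤ (interleavings-nonneg G minDegree O a b) ≤-refl))))

theorem2p5 : ∀ {n : ℕ} (G : Graph n)
    → (∀ (u : Fin n) → 31 ℕ.* n ℕ.≤ 33 ℕ.* degree G u)
    → ∀ (O : Fin 4 → Fin n) → isOrdClique G O ≡ true
    → W′_G G O ≤ 1ℚ
theorem2p5 G minDegree O _ = +-monoʳ-≤ 1ℚ (neg-antimono-≤ 0≤12W)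
  where
  0≤12W : 0ℚ ≤ (fromℕ 12 * recip (Wt G (take 3 (VF.toList O)))) * W_G G O
  0≤12W = 0≤* (0≤* (fromℕ-nonNeg 12) (recip-nonNeg _ (weight-nonNeg G (take 3 (VF.toList O))))) (W_G-nonneg G O minDegree)
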